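{- Fix $m\ge 0$. Let $u_0=G$, $u_1=F$, $u_2=(F+G)^2G$, let $L$ be the $\mathbb{Z}/2$-span of the $u_iG^{2n}$ with $0\le i\le 2$, $0\le n\le m$, and let $L^*$ be the set of $(r^2+r)g(r^2)$ with $g\in\mathbb{Z}/2[t]$ of degree $\le 4m+3$. Then $L\subseteq L^*$ and $\{f\in L: (U+I)^2f=0\}=\{f\in L^*: (U+I)^2f=0\}$.
   Context: $\mathbb{Z}/2[r]$, $\mathbb{Z}/2[t]$ are polynomial rings over the field with two elements; $F=r(r+1)^3$, $G=r^3(r+1)$. $\mathbb{Z}/2[r]$ is a free $\mathbb{Z}/2[G]$-module with basis $1,r,r^2,r^3$. $U:\mathbb{Z}/2[r]\to\mathbb{Z}/2[r]$ is $U\big(\sum_{i=0}^3 g_i(G)r^i\big)=\sum_{i=0}^3 g_i(F)U(r^i)$ with $U(1)=1$, $U(r)=r$, $U(r^2)=r^2$, $U(r^3)=r^3+r^2+r$; $I$ is the identity. -}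

module Defs where

open import Data.Bool using (Bool; true; false; _xor_; if_then_else_)
open import Data.List using (List; []; _∷_; length; map; replicate)
open import Data.Nat using (ℕ; zero; suc; _∸_; _<ᵇ_)
open import Data.Product using (_×_; _,_; proj₁; proj₂; Σ; ∃)
open import Data.Fin using (Fin; toℕ)
open import Data.Vec using (Vec; toList)
open import Relation.Binary.PropositionalEquality using (_≡_)

-- Polynomials over Z/2 (in one variable, r or t), as little-endian
-- coefficient lists: b₀ ∷ b₁ ∷ … represents b₀ + b₁ x + b₂ x² + …
-- Trailing zeros are allowed; equality of polynomials is _≈_ below.

Poly : Set
Poly = List Bool

coeff : Poly → ℕ → Bool
coeff []      _       = false
coeff (b ∷ p) zero    = b
coeff (b ∷ p) (suc n) = coeff p n

infix 4 _≈_
_≈_ : Poly → Poly → Set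
p ≈ q = ∀ n → coeff p n ≡ coeff q n

0ₚ : Poly
0ₚ = []

1ₚ : Poly
1ₚ = true ∷ []

X : Poly
X = false ∷ true ∷ []

infixl 6 _+ₚ_
infixl 7 _*ₚ_

_+ₚ_ : Poly → Poly → Poly
[]      +ₚ q       = q
(a ∷ p) +ₚ []      = a ∷ p
(a ∷ p) +ₚ (b ∷ q) = (a xor b) ∷ (p +ₚ q)

_*ₚ_ : Poly → Poly → Poly
[]      *ₚ q = []
(a ∷ p) *ₚ q = (if a then q else []) +ₚ (false ∷ (p *ₚ q))

_∘ₚ_ : Poly → Poly → Poly
[]      ∘ₚ h = []
(a ∷ p) ∘ₚ h = (a ∷ []) +ₚ (h *ₚ (p ∘ₚ h))

_^ₚ_ : Poly → ℕ → Poly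
p ^ₚ zero  = 1ₚ
p ^ₚ suc n = p *ₚ (p ^ₚ n)

Fp : Poly
Fp = X *ₚ ((X +ₚ 1ₚ) ^ₚ 3)

Gp : Poly
Gp = (X ^ₚ 3) *ₚ (X +ₚ 1ₚ)

-- The decomposition p = Σ_{i=0}^{3} g_i(G) r^i (Z/2[r] is free over
-- Z/2[G] with basis 1, r, r², r³).  It is computed from the G-adic
-- expansion p = Σ_j c_j(r) G^j with deg c_j < 4 = deg G: then
-- g_i(t) = Σ_j (coefficient of r^i in c_j) t^j.

trim : Poly → Poly
trim [] = []
trim (b ∷ p) with trim p
... | []     = if b then true ∷ [] else []
... | x ∷ xs = b ∷ x ∷ xs

monomial : ℕ → Poly
monomial n = replicate n false Data.List.++ (true ∷ [])

divmodG : ℕ → Poly → Poly × Poly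
divmodG zero    p = [] , trim p
divmodG (suc k) p with trim p
... | t with length t <ᵇ 5
...   | true  = [] , t
...   | false =
  let s  = length t ∸ 5
      qr = divmodG k (t +ₚ (monomial s *ₚ Gp))
  in (monomial s +ₚ proj₁ qr) , proj₂ qr

gadic : ℕ → Poly → List Poly
gadic zero    p = []
gadic (suc k) p =
  let qr = divmodG (length p) p in proj₂ qr ∷ gadic k (proj₁ qr)

coord : Poly → ℕ → Poly
coord p i = map (λ c → coeff c i) (gadic (suc (length p)) p)

Ubasis : ℕ → Poly
Ubasis 3 = (X ^ₚ 3) +ₚ (X ^ₚ 2) +ₚ X
Ubasis i = X ^ₚ i

U : Poly → Poly
U p = ((coord p 0 ∘ₚ Fp) *ₚ Ubasis 0)
   +ₚ ((coord p 1 ∘ₚ Fp) *ₚ Ubasis 1)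
   +ₚ ((coord p 2 ∘ₚ Fp) *ₚ Ubasis 2)
   +ₚ ((coord p 3 ∘ₚ Fp) *ₚ Ubasis 3)

U+I : Poly → Poly
U+I p = U p +ₚ p

u : Fin 3 → Poly
u Fin.zero             = Gp
u (Fin.suc Fin.zero)   = Fp
u (Fin.suc (Fin.suc Fin.zero)) = ((Fp +ₚ Gp) ^ₚ 2) *ₚ Gp

sumFin : (k : ℕ) → (Fin k → Poly) → Poly
sumFin zero    f = []
sumFin (suc k) f = f Fin.zero +ₚ sumFin k (λ j → f (Fin.suc j))

combL : (m : ℕ) → (Fin 3 → Fin (suc m) → Bool) → Poly
combL m c = sumFin 3 λ i → sumFin (suc m) λ n →
  if c i n then u i *ₚ (Gp ^ₚ (2 Data.Nat.* toℕ n)) else []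

InL : ℕ → Poly → Set
InL m f = Σ (Fin 3 → Fin (suc m) → Bool) λ c → f ≈ combL m c

-- f ∈ L*  (f = (r²+r) g(r²) with g ∈ Z/2[t], deg g ≤ 4m+3;
-- g is given by its 4m+4 coefficients)
InL* : ℕ → Poly → Set
InL* m f = Σ (Vec Bool (suc (4 Data.Nat.* m Data.Nat.+ 3))) λ g →
  f ≈ (((X ^ₚ 2) +ₚ X) *ₚ (toList g ∘ₚ (X ^ₚ 2)))

-- Substituting r ↦ r+1 swaps F and G and turns Σ gᵢ(G) rⁱ into Σ gᵢ(F) (r+1)ⁱ, which differs
-- from U by c(F), where c = g₁ + g₂ + g₃. Since this substitution is an involution,
-- (U+I)² f = c_f(G) + c_{Uf}(F). Now F = r·(unit) and G = r·(non-unit), so comparing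
-- coefficients at r = 0 shows that c(G) = d(F) with c(0) = 0 forces c = 0.
-- For f = (r²+r) g(r²) ∈ L* with g = Σ aᵢ(G) rⁱ one computes c_f = r (a₂+a₃)(r²), so
-- (U+I)² f = 0 gives a₂ = a₃, and then f = G (a₀+a₁)(G²) + F a₀(G²) + (F+G)²G a₃(G²) ∈ L.
-- Conversely u_i = (r²+r) v_i(r²) with v = t, t+1, t²+t³ gives L ⊆ L*; the degree bounds
-- come from deg G = 4.

module Submission where

open import Algebra.Bundles using (CommutativeRing)
open import Algebra.Structures using (IsCommutativeRing)
open import Data.Bool using (Bool; true; false; _xor_; _∧_; not; T; if_then_else_)
open import Data.Bool.Properties
  using (xor-assoc; xor-comm; xor-identityʳ; xor-same; ∧-comm)
open import Data.List using (List; []; _∷_; drop; length; map)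
open import Function using (_∘_)
open import Data.List.Relation.Unary.All using (All; []; _∷_)
open import Data.Maybe using (Maybe; just; nothing)
open import Data.Nat
  using (ℕ; zero; suc; pred; _+_; _*_; _∸_; _⊔_; _≤_; _<_; _<ᵇ_; z≤n; s≤s)
open import Data.Nat.Properties
  using ( +-identityʳ; +-comm; +-suc; *-suc; ≤-refl; ≤-trans; ≤-reflexive; m≤m+n; m≤n+m
        ; +-monoˡ-≤; +-monoʳ-≤; m≤n⇒m≤1+n; n≤1+n; m≤n*m; m≤m⊔n; m≤n⊔m; m∸n+n≡m
        ; ∸-monoˡ-≤; m≤n⇒m<n∨m≡n; <⇒≤pred; <ᵇ⇒<; <⇒<ᵇ; ≮⇒≥; suc-injective)
open import Data.Product using (_×_; _,_; proj₁; proj₂)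
open import Data.Sum using (inj₁; inj₂)
open import Data.Fin using (Fin; zero; suc; toℕ)
open import Data.Unit using (tt)
open import Data.Vec using (Vec; toList; tabulate)
open import Data.Vec.Properties using (length-toList)
open import Relation.Binary.Bundles using (Setoid)
open import Relation.Binary.PropositionalEquality
  using (_≡_; refl; sym; trans; cong; cong₂; subst; module ≡-Reasoning)
import Relation.Binary.Reasoning.Setoid as SetoidReasoning
import Tactic.RingSolver.Core.AlmostCommutativeRing as ACR

open import Defs

-- ≈ is wrapped in a record so that it does not unfold to a Π-type:
-- otherwise Agda could not infer the implicit polynomials of ≋-lemmas.
infix 4 _≋_
record _≋_ (p q : Poly) : Set where
  constructor ≈⇒≋
  field ≋⇒≈ : p ≈ q
open _≋_ public

≋-refl : ∀ {p} → p ≋ p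
≋-refl = ≈⇒≋ λ _ → refl

≋-sym : ∀ {p q} → p ≋ q → q ≋ p
≋-sym e = ≈⇒≋ λ n → sym (≋⇒≈ e n)

≋-trans : ∀ {p q r} → p ≋ q → q ≋ r → p ≋ r
≋-trans e f = ≈⇒≋ λ n → trans (≋⇒≈ e n) (≋⇒≈ f n)

≡⇒≋ : ∀ {p q} → p ≡ q → p ≋ q
≡⇒≋ refl = ≋-refl

≋-setoid : Setoid _ _
≋-setoid = record
  { Carrier = Poly ; _≈_ = _≋_
  ; isEquivalence = record { refl = ≋-refl ; sym = ≋-sym ; trans = ≋-trans } }

module ≋-Reasoning = SetoidReasoning ≋-setoid

∷-cong : ∀ {a b p q} → a ≡ b → p ≋ q → a ∷ p ≋ b ∷ q
∷-cong a≡b p≋q = ≈⇒≋ λ { zero → a≡b ; (suc n) → ≋⇒≈ p≋q n }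

∷-≋-[] : ∀ {a p} → a ≡ false → p ≋ [] → a ∷ p ≋ []
∷-≋-[] a≡false p≋[] = ≈⇒≋ λ { zero → a≡false ; (suc n) → ≋⇒≈ p≋[] n }

coeff₀ : Poly → Bool
coeff₀ p = coeff p 0

divX : Poly → Poly
divX = drop 1

coeff-divX : ∀ p n → coeff p (suc n) ≡ coeff (divX p) n
coeff-divX []      n = refl
coeff-divX (_ ∷ _) n = refl

divX-cong : ∀ {p q} → p ≋ q → divX p ≋ divX q
divX-cong {p} {q} e =
  ≈⇒≋ λ n → trans (sym (coeff-divX p n)) (trans (≋⇒≈ e (suc n)) (coeff-divX q n))

≋-coeff₀∷divX : ∀ p → p ≋ coeff₀ p ∷ divX p
≋-coeff₀∷divX []      = ≋-sym (∷-≋-[] refl ≋-refl)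
≋-coeff₀∷divX (_ ∷ _) = ≋-refl

coeff-+ₚ : ∀ p q n → coeff (p +ₚ q) n ≡ coeff p n xor coeff q n
coeff-+ₚ []      q       n       = refl
coeff-+ₚ (a ∷ p) []      n       = sym (xor-identityʳ _)
coeff-+ₚ (a ∷ p) (b ∷ q) zero    = refl
coeff-+ₚ (a ∷ p) (b ∷ q) (suc n) = coeff-+ₚ p q n

+ₚ-cong : ∀ {p p′ q q′} → p ≋ p′ → q ≋ q′ → p +ₚ q ≋ p′ +ₚ q′
+ₚ-cong {p} {p′} {q} {q′} e f = ≈⇒≋ λ n → trans (coeff-+ₚ p q n)
  (trans (cong₂ _xor_ (≋⇒≈ e n) (≋⇒≈ f n)) (sym (coeff-+ₚ p′ q′ n)))

+ₚ-assoc : ∀ p q r → (p +ₚ q) +ₚ r ≋ p +ₚ (q +ₚ r)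
+ₚ-assoc p q r = ≈⇒≋ λ n → trans (coeff-+ₚ (p +ₚ q) r n)
  (trans (cong (_xor coeff r n) (coeff-+ₚ p q n))
  (trans (xor-assoc (coeff p n) (coeff q n) (coeff r n))
  (trans (cong (coeff p n xor_) (sym (coeff-+ₚ q r n))) (sym (coeff-+ₚ p (q +ₚ r) n)))))

+ₚ-comm : ∀ p q → p +ₚ q ≋ q +ₚ p
+ₚ-comm p q = ≈⇒≋ λ n → trans (coeff-+ₚ p q n)
  (trans (xor-comm (coeff p n) (coeff q n)) (sym (coeff-+ₚ q p n)))

+ₚ-identityʳ : ∀ p → p +ₚ [] ≋ p
+ₚ-identityʳ p = ≈⇒≋ λ n → trans (coeff-+ₚ p [] n) (xor-identityʳ (coeff p n))

+ₚ-self : ∀ p → p +ₚ p ≋ []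
+ₚ-self p = ≈⇒≋ λ n → trans (coeff-+ₚ p p n) (xor-same (coeff p n))

+ₚ-swap : ∀ p q r → p +ₚ (q +ₚ r) ≋ q +ₚ (p +ₚ r)
+ₚ-swap p q r = begin
  p +ₚ (q +ₚ r) ≈⟨ ≋-sym (+ₚ-assoc p q r) ⟩
  (p +ₚ q) +ₚ r ≈⟨ +ₚ-cong (+ₚ-comm p q) ≋-refl ⟩
  (q +ₚ p) +ₚ r ≈⟨ +ₚ-assoc q p r ⟩
  q +ₚ (p +ₚ r) ∎
  where open ≋-Reasoning

+ₚ-interchange : ∀ p q r s → (p +ₚ q) +ₚ (r +ₚ s) ≋ (p +ₚ r) +ₚ (q +ₚ s)
+ₚ-interchange p q r s = begin
  (p +ₚ q) +ₚ (r +ₚ s) ≈⟨ +ₚ-assoc p q (r +ₚ s) ⟩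
  p +ₚ (q +ₚ (r +ₚ s)) ≈⟨ +ₚ-cong (≋-refl {p}) (+ₚ-swap q r s) ⟩
  p +ₚ (r +ₚ (q +ₚ s)) ≈⟨ ≋-sym (+ₚ-assoc p r (q +ₚ s)) ⟩
  (p +ₚ r) +ₚ (q +ₚ s) ∎
  where open ≋-Reasoning

+ₚ≋[]⇒≋ : ∀ {p q} → p +ₚ q ≋ [] → p ≋ q
+ₚ≋[]⇒≋ {p} {q} e = begin
  p                ≈⟨ ≋-sym (+ₚ-identityʳ p) ⟩
  p +ₚ []          ≈⟨ +ₚ-cong (≋-refl {p}) (≋-sym (+ₚ-self q)) ⟩
  p +ₚ (q +ₚ q)    ≈⟨ ≋-sym (+ₚ-assoc p q q) ⟩
  (p +ₚ q) +ₚ q    ≈⟨ +ₚ-cong e ≋-refl ⟩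
  q                ∎
  where open ≋-Reasoning

scale : Bool → Poly → Poly
scale a q = if a then q else []

scale-cong : ∀ a {q q′} → q ≋ q′ → scale a q ≋ scale a q′
scale-cong true  e = e
scale-cong false e = ≋-refl

scale-xor : ∀ a b q → scale (a xor b) q ≋ scale a q +ₚ scale b q
scale-xor true  true  q = ≋-sym (+ₚ-self q)
scale-xor true  false q = ≋-sym (+ₚ-identityʳ q)
scale-xor false b     q = ≋-refl

scale-∷ : ∀ a b q → scale a (b ∷ q) ≋ (a ∧ b) ∷ scale a q
scale-∷ true  b q = ≋-refl
scale-∷ false b q = ≋-sym (∷-≋-[] refl ≋-refl)

scale-*ₚ : ∀ a q r → scale a q *ₚ r ≋ scale a (q *ₚ r)
scale-*ₚ true  q r = ≋-refl
scale-*ₚ false q r = ≋-refl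

*ₚ-zeroˡ : ∀ {p} q → p ≋ [] → p *ₚ q ≋ []
*ₚ-zeroˡ {[]}    q e = ≋-refl
*ₚ-zeroˡ {a ∷ p} q e with ≋⇒≈ e 0
... | refl = ∷-≋-[] refl (*ₚ-zeroˡ {p} q (divX-cong e))

*ₚ-zeroʳ : ∀ p → p *ₚ [] ≋ []
*ₚ-zeroʳ []          = ≋-refl
*ₚ-zeroʳ (true ∷ p)  = ∷-≋-[] refl (*ₚ-zeroʳ p)
*ₚ-zeroʳ (false ∷ p) = ∷-≋-[] refl (*ₚ-zeroʳ p)

*ₚ-congˡ : ∀ {p p′} q → p ≋ p′ → p *ₚ q ≋ p′ *ₚ q
*ₚ-congˡ {[]}    q e = ≋-sym (*ₚ-zeroˡ q (≋-sym e))
*ₚ-congˡ {a ∷ p} {[]} q e = *ₚ-zeroˡ q e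
*ₚ-congˡ {a ∷ p} {b ∷ p′} q e with ≋⇒≈ e 0
... | refl = +ₚ-cong (≋-refl {scale a q}) (∷-cong refl (*ₚ-congˡ {p} {p′} q (divX-cong e)))

*ₚ-congʳ : ∀ p {q q′} → q ≋ q′ → p *ₚ q ≋ p *ₚ q′
*ₚ-congʳ []      e = ≋-refl
*ₚ-congʳ (a ∷ p) e = +ₚ-cong (scale-cong a e) (∷-cong refl (*ₚ-congʳ p e))

*ₚ-cong : ∀ {p p′ q q′} → p ≋ p′ → q ≋ q′ → p *ₚ q ≋ p′ *ₚ q′
*ₚ-cong {p′ = p′} {q = q} e f = ≋-trans (*ₚ-congˡ q e) (*ₚ-congʳ p′ f)

*ₚ-distribʳ : ∀ q p p′ → (p +ₚ p′) *ₚ q ≋ p *ₚ q +ₚ p′ *ₚ q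
*ₚ-distribʳ q []      p′       = ≋-refl
*ₚ-distribʳ q (a ∷ p) []       = ≋-sym (+ₚ-identityʳ _)
*ₚ-distribʳ q (a ∷ p) (b ∷ p′) =
  ≋-trans (+ₚ-cong (scale-xor a b q) (∷-cong refl (*ₚ-distribʳ q p p′)))
          (+ₚ-interchange (scale a q) (scale b q) (false ∷ p *ₚ q) (false ∷ p′ *ₚ q))

*ₚ-∷ʳ : ∀ p b q → p *ₚ (b ∷ q) ≋ scale b p +ₚ (false ∷ p *ₚ q)
*ₚ-∷ʳ []      true  q = ≋-sym (∷-≋-[] refl ≋-refl)
*ₚ-∷ʳ []      false q = ≋-sym (∷-≋-[] refl ≋-refl)
*ₚ-∷ʳ (a ∷ p) b     q = begin
  scale a (b ∷ q) +ₚ (false ∷ p *ₚ (b ∷ q))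
    ≈⟨ +ₚ-cong (scale-∷ a b q) (∷-cong refl (*ₚ-∷ʳ p b q)) ⟩
  ((a ∧ b) xor false) ∷ (scale a q +ₚ (scale b p +ₚ (false ∷ p *ₚ q)))
    ≈⟨ ∷-cong (cong (_xor false) (∧-comm a b)) (+ₚ-swap (scale a q) (scale b p) _) ⟩
  ((b ∧ a) xor false) ∷ (scale b p +ₚ (scale a q +ₚ (false ∷ p *ₚ q)))
    ≈⟨ ≋-sym (+ₚ-cong (scale-∷ b a p) ≋-refl) ⟩
  scale b (a ∷ p) +ₚ (false ∷ (scale a q +ₚ (false ∷ p *ₚ q))) ∎
  where open ≋-Reasoning

*ₚ-comm : ∀ p q → p *ₚ q ≋ q *ₚ p
*ₚ-comm []      q = ≋-sym (*ₚ-zeroʳ q)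
*ₚ-comm (a ∷ p) q = ≋-sym (≋-trans (*ₚ-∷ʳ q a p)
  (+ₚ-cong (≋-refl {scale a q}) (∷-cong refl (*ₚ-comm q p))))

*ₚ-distribˡ : ∀ p q q′ → p *ₚ (q +ₚ q′) ≋ p *ₚ q +ₚ p *ₚ q′
*ₚ-distribˡ p q q′ = begin
  p *ₚ (q +ₚ q′)        ≈⟨ *ₚ-comm p (q +ₚ q′) ⟩
  (q +ₚ q′) *ₚ p        ≈⟨ *ₚ-distribʳ p q q′ ⟩
  q *ₚ p +ₚ q′ *ₚ p     ≈⟨ +ₚ-cong (*ₚ-comm q p) (*ₚ-comm q′ p) ⟩
  p *ₚ q +ₚ p *ₚ q′     ∎
  where open ≋-Reasoning

*ₚ-assoc : ∀ p q r → (p *ₚ q) *ₚ r ≋ p *ₚ (q *ₚ r)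
*ₚ-assoc []      q r = ≋-refl
*ₚ-assoc (a ∷ p) q r =
  ≋-trans (*ₚ-distribʳ r (scale a q) (false ∷ p *ₚ q))
          (+ₚ-cong (scale-*ₚ a q r) (∷-cong refl (*ₚ-assoc p q r)))

*ₚ-identityˡ : ∀ q → 1ₚ *ₚ q ≋ q
*ₚ-identityˡ q = ≋-trans (+ₚ-cong (≋-refl {q}) (∷-≋-[] refl ≋-refl)) (+ₚ-identityʳ q)

*ₚ-identityʳ : ∀ q → q *ₚ 1ₚ ≋ q
*ₚ-identityʳ q = ≋-trans (*ₚ-comm q 1ₚ) (*ₚ-identityˡ q)

+ₚ-*ₚ-isCommutativeRing : IsCommutativeRing _≋_ _+ₚ_ _*ₚ_ (λ p → p) [] 1ₚ
+ₚ-*ₚ-isCommutativeRing = record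
  { isRing = record
    { +-isAbelianGroup = record
      { isGroup = record
        { isMonoid = record
          { isSemigroup = record
            { isMagma = record
              { isEquivalence = Setoid.isEquivalence ≋-setoid ; ∙-cong = +ₚ-cong }
            ; assoc = +ₚ-assoc }
          ; identity = (λ _ → ≋-refl) , +ₚ-identityʳ }
        ; inverse = +ₚ-self , +ₚ-self
        ; ⁻¹-cong = λ e → e }
      ; comm = +ₚ-comm }
    ; *-cong = *ₚ-cong
    ; *-assoc = *ₚ-assoc
    ; *-identity = *ₚ-identityˡ , *ₚ-identityʳ
    ; distrib = *ₚ-distribˡ , *ₚ-distribʳ }
  ; *-comm = *ₚ-comm }

+ₚ-*ₚ-commutativeRing : CommutativeRing _ _
+ₚ-*ₚ-commutativeRing = record { isCommutativeRing = +ₚ-*ₚ-isCommutativeRing }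

_==ₚ_ : Poly → Poly → Bool
[]      ==ₚ []      = true
[]      ==ₚ (b ∷ q) = not b ∧ ([] ==ₚ q)
(a ∷ p) ==ₚ []      = not a ∧ (p ==ₚ [])
(a ∷ p) ==ₚ (b ∷ q) = (if a then b else not b) ∧ (p ==ₚ q)

==ₚ-sound : ∀ p q → T (p ==ₚ q) → p ≈ q
==ₚ-sound []          []          t n       = refl
==ₚ-sound []          (false ∷ q) t zero    = refl
==ₚ-sound []          (false ∷ q) t (suc n) = ==ₚ-sound [] q t n
==ₚ-sound (false ∷ p) []          t zero    = refl
==ₚ-sound (false ∷ p) []          t (suc n) = ==ₚ-sound p [] t n
==ₚ-sound (true ∷ p)  (true ∷ q)  t zero    = refl
==ₚ-sound (false ∷ p) (false ∷ q) t zero    = refl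
==ₚ-sound (true ∷ p)  (true ∷ q)  t (suc n) = ==ₚ-sound p q t n
==ₚ-sound (false ∷ p) (false ∷ q) t (suc n) = ==ₚ-sound p q t n

by-evaluation : ∀ p q → {T (p ==ₚ q)} → p ≋ q
by-evaluation p q {t} = ≈⇒≋ (==ₚ-sound p q t)

[]≟ₚ_ : ∀ p → Maybe ([] ≋ p)
[]≟ₚ p with [] ==ₚ p in eq
... | true  = just (≈⇒≋ (==ₚ-sound [] p (subst T (sym eq) tt)))
... | false = nothing

open import Tactic.RingSolver.NonReflective
  (ACR.fromCommutativeRing +ₚ-*ₚ-commutativeRing []≟ₚ_) using (solve; _⊜_)
open import Tactic.RingSolver.Core.Expression using (Expr; Κ; _⊕_; _⊗_; ⊝_; _⊛_)

constant : Bool → Poly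
constant a = a ∷ []

scale≋constant*ₚ : ∀ a q → scale a q ≋ constant a *ₚ q
scale≋constant*ₚ a q = ≋-sym
  (≋-trans (+ₚ-cong (≋-refl {scale a q}) (∷-≋-[] refl ≋-refl)) (+ₚ-identityʳ (scale a q)))

false∷≋X*ₚ : ∀ p → false ∷ p ≋ X *ₚ p
false∷≋X*ₚ p = ∷-cong refl (≋-sym (*ₚ-identityˡ p))

∷≋constant+X*ₚ : ∀ a p → a ∷ p ≋ constant a +ₚ X *ₚ p
∷≋constant+X*ₚ a p = ≋-trans (∷-cong (sym (xor-identityʳ a)) ≋-refl)
                              (+ₚ-cong (≋-refl {constant a}) (false∷≋X*ₚ p))

∘ₚ-+ₚ : ∀ p q h → (p +ₚ q) ∘ₚ h ≋ p ∘ₚ h +ₚ q ∘ₚ h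
∘ₚ-+ₚ []      q       h = ≋-refl
∘ₚ-+ₚ (a ∷ p) []      h = ≋-sym (+ₚ-identityʳ _)
∘ₚ-+ₚ (a ∷ p) (b ∷ q) h = begin
  constant (a xor b) +ₚ h *ₚ ((p +ₚ q) ∘ₚ h)
    ≈⟨ +ₚ-cong (≋-refl {constant (a xor b)}) (*ₚ-congʳ h (∘ₚ-+ₚ p q h)) ⟩
  (constant a +ₚ constant b) +ₚ h *ₚ (p ∘ₚ h +ₚ q ∘ₚ h)
    ≈⟨ solve 5 (λ A B H P Q → ((A ⊕ B) ⊕ H ⊗ (P ⊕ Q)) ⊜ ((A ⊕ H ⊗ P) ⊕ (B ⊕ H ⊗ Q)))
         ≋-refl (constant a) (constant b) h (p ∘ₚ h) (q ∘ₚ h) ⟩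
  (constant a +ₚ h *ₚ (p ∘ₚ h)) +ₚ (constant b +ₚ h *ₚ (q ∘ₚ h)) ∎
  where open ≋-Reasoning

∘ₚ-zeroˡ : ∀ {p} h → p ≋ [] → p ∘ₚ h ≋ []
∘ₚ-zeroˡ {[]}    h e = ≋-refl
∘ₚ-zeroˡ {a ∷ p} h e with ≋⇒≈ e 0
... | refl = ≋-trans (+ₚ-cong (∷-≋-[] refl ≋-refl)
                       (≋-trans (*ₚ-congʳ h (∘ₚ-zeroˡ {p} h (divX-cong e))) (*ₚ-zeroʳ h)))
                     ≋-refl

∘ₚ-congˡ : ∀ {p p′} h → p ≋ p′ → p ∘ₚ h ≋ p′ ∘ₚ h
∘ₚ-congˡ {[]}    h e = ≋-sym (∘ₚ-zeroˡ h (≋-sym e))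
∘ₚ-congˡ {a ∷ p} {[]} h e = ∘ₚ-zeroˡ h e
∘ₚ-congˡ {a ∷ p} {b ∷ p′} h e with ≋⇒≈ e 0
... | refl = +ₚ-cong (≋-refl {constant a}) (*ₚ-congʳ h (∘ₚ-congˡ {p} {p′} h (divX-cong e)))

∘ₚ-congʳ : ∀ p {h h′} → h ≋ h′ → p ∘ₚ h ≋ p ∘ₚ h′
∘ₚ-congʳ []      e = ≋-refl
∘ₚ-congʳ (a ∷ p) e = +ₚ-cong (≋-refl {constant a}) (*ₚ-cong e (∘ₚ-congʳ p e))

constant-∘ₚ : ∀ a h → constant a ∘ₚ h ≋ constant a
constant-∘ₚ a h =
  ≋-trans (+ₚ-cong (≋-refl {constant a}) (*ₚ-zeroʳ h)) (+ₚ-identityʳ (constant a))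

scale-∘ₚ : ∀ a q h → scale a q ∘ₚ h ≋ scale a (q ∘ₚ h)
scale-∘ₚ true  q h = ≋-refl
scale-∘ₚ false q h = ≋-refl

∘ₚ-*ₚ : ∀ p q h → (p *ₚ q) ∘ₚ h ≋ p ∘ₚ h *ₚ q ∘ₚ h
∘ₚ-*ₚ []      q h = ≋-refl
∘ₚ-*ₚ (a ∷ p) q h = begin
  (scale a q +ₚ (false ∷ p *ₚ q)) ∘ₚ h
    ≈⟨ ∘ₚ-+ₚ (scale a q) (false ∷ p *ₚ q) h ⟩
  scale a q ∘ₚ h +ₚ (false ∷ p *ₚ q) ∘ₚ h
    ≈⟨ +ₚ-cong (≋-trans (scale-∘ₚ a q h) (scale≋constant*ₚ a Q))
               (+ₚ-cong (∷-≋-[] refl ≋-refl) (*ₚ-congʳ h (∘ₚ-*ₚ p q h))) ⟩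
  constant a *ₚ Q +ₚ ([] +ₚ h *ₚ (P *ₚ Q))
    ≈⟨ solve 4 (λ A Q H P → (A ⊗ Q ⊕ H ⊗ (P ⊗ Q)) ⊜ ((A ⊕ H ⊗ P) ⊗ Q))
         ≋-refl (constant a) Q h P ⟩
  (constant a +ₚ h *ₚ P) *ₚ Q ∎
  where
  open ≋-Reasoning
  P = p ∘ₚ h
  Q = q ∘ₚ h

∘ₚ-assoc : ∀ p h k → (p ∘ₚ h) ∘ₚ k ≋ p ∘ₚ (h ∘ₚ k)
∘ₚ-assoc []      h k = ≋-refl
∘ₚ-assoc (a ∷ p) h k = begin
  (constant a +ₚ h *ₚ (p ∘ₚ h)) ∘ₚ k
    ≈⟨ ∘ₚ-+ₚ (constant a) (h *ₚ (p ∘ₚ h)) k ⟩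
  constant a ∘ₚ k +ₚ (h *ₚ (p ∘ₚ h)) ∘ₚ k
    ≈⟨ +ₚ-cong (constant-∘ₚ a k)
               (≋-trans (∘ₚ-*ₚ h (p ∘ₚ h) k) (*ₚ-congʳ (h ∘ₚ k) (∘ₚ-assoc p h k))) ⟩
  constant a +ₚ (h ∘ₚ k) *ₚ (p ∘ₚ (h ∘ₚ k)) ∎
  where open ≋-Reasoning

X-∘ₚ : ∀ h → X ∘ₚ h ≋ h
X-∘ₚ h = begin
  constant false +ₚ h *ₚ (constant true ∘ₚ h)
    ≈⟨ +ₚ-cong (∷-≋-[] refl ≋-refl) (*ₚ-congʳ h (constant-∘ₚ true h)) ⟩
  h *ₚ 1ₚ
    ≈⟨ *ₚ-identityʳ h ⟩
  h ∎
  where open ≋-Reasoning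

∘ₚ-X : ∀ p → p ∘ₚ X ≋ p
∘ₚ-X []      = ≋-refl
∘ₚ-X (a ∷ p) = ≋-trans (+ₚ-cong (≋-refl {constant a}) (*ₚ-congʳ X (∘ₚ-X p)))
                       (≋-sym (∷≋constant+X*ₚ a p))

^ₚ-cong : ∀ {p q} n → p ≋ q → p ^ₚ n ≋ q ^ₚ n
^ₚ-cong zero    e = ≋-refl
^ₚ-cong (suc n) e = *ₚ-cong e (^ₚ-cong n e)

∘ₚ-^ₚ : ∀ p n h → (p ^ₚ n) ∘ₚ h ≋ (p ∘ₚ h) ^ₚ n
∘ₚ-^ₚ p zero    h = constant-∘ₚ true h
∘ₚ-^ₚ p (suc n) h =
  ≋-trans (∘ₚ-*ₚ p (p ^ₚ n) h) (*ₚ-congʳ (p ∘ₚ h) (∘ₚ-^ₚ p n h))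

^ₚ-*ₚ : ∀ p q n → (p *ₚ q) ^ₚ n ≋ p ^ₚ n *ₚ q ^ₚ n
^ₚ-*ₚ p q zero    = ≋-sym (*ₚ-identityˡ 1ₚ)
^ₚ-*ₚ p q (suc n) = ≋-trans (*ₚ-congʳ (p *ₚ q) (^ₚ-*ₚ p q n))
  (solve 4 (λ P Q A B → ((P ⊗ Q) ⊗ (A ⊗ B)) ⊜ ((P ⊗ A) ⊗ (Q ⊗ B)))
     ≋-refl p q (p ^ₚ n) (q ^ₚ n))

^ₚ-+ : ∀ p m n → p ^ₚ (m + n) ≋ p ^ₚ m *ₚ p ^ₚ n
^ₚ-+ p zero    n = ≋-sym (*ₚ-identityˡ _)
^ₚ-+ p (suc m) n =
  ≋-trans (*ₚ-congʳ p (^ₚ-+ p m n)) (≋-sym (*ₚ-assoc p (p ^ₚ m) (p ^ₚ n)))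

^ₚ-2* : ∀ p n → p ^ₚ (2 * n) ≋ (p *ₚ p) ^ₚ n
^ₚ-2* p n = begin
  p ^ₚ (n + (n + 0))   ≡⟨ cong (λ k → p ^ₚ (n + k)) (+-identityʳ n) ⟩
  p ^ₚ (n + n)         ≈⟨ ^ₚ-+ p n n ⟩
  p ^ₚ n *ₚ p ^ₚ n     ≈⟨ ≋-sym (^ₚ-*ₚ p p n) ⟩
  (p *ₚ p) ^ₚ n        ∎
  where open ≋-Reasoning

-- Degree bounds

record Deg< (n : ℕ) (p : Poly) : Set where
  constructor deg<
  field vanishes : ∀ k → n ≤ k → coeff p k ≡ false
open Deg< public

Deg<-mono : ∀ {m n p} → m ≤ n → Deg< m p → Deg< n p
Deg<-mono m≤n d = deg< λ k n≤k → vanishes d k (≤-trans m≤n n≤k)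

Deg<-resp-≋ : ∀ {n p q} → p ≋ q → Deg< n p → Deg< n q
Deg<-resp-≋ e d = deg< λ k n≤k → trans (sym (≋⇒≈ e k)) (vanishes d k n≤k)

Deg<-length : ∀ p → Deg< (length p) p
Deg<-length []      = deg< λ _ _ → refl
Deg<-length (b ∷ p) = deg< λ { (suc k) (s≤s le) → vanishes (Deg<-length p) k le }

Deg<-+ₚ : ∀ {n p q} → Deg< n p → Deg< n q → Deg< n (p +ₚ q)
Deg<-+ₚ {p = p} {q} d d′ = deg< λ k n≤k →
  trans (coeff-+ₚ p q k) (cong₂ _xor_ (vanishes d k n≤k) (vanishes d′ k n≤k))

Deg<0⇒≋[] : ∀ {p} → Deg< 0 p → p ≋ []
Deg<0⇒≋[] d = ≈⇒≋ λ k → vanishes d k z≤n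

≋[]⇒Deg< : ∀ {n p} → p ≋ [] → Deg< n p
≋[]⇒Deg< e = deg< λ k _ → ≋⇒≈ e k

Deg<-divX : ∀ {n p} → Deg< n p → Deg< (pred n) (divX p)
Deg<-divX {n} {p} d = deg< λ k le → trans (sym (coeff-divX p k)) (vanishes d (suc k) (lemma n le))
  where
  lemma : ∀ n {k} → pred n ≤ k → n ≤ suc k
  lemma zero    _  = z≤n
  lemma (suc n) le = s≤s le

divX-Deg< : ∀ {n p} → Deg< n (divX p) → Deg< (suc n) p
divX-Deg< {p = p} d = deg< λ { (suc k) (s≤s le) → trans (coeff-divX p k) (vanishes d k le) }

Deg<-*ₚ : ∀ a b {p q} → Deg< a p → Deg< (suc b) q → Deg< (a + b) (p *ₚ q)
Deg<-*ₚ a       b {[]}    {q} _ _ = deg< λ _ _ → refl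
Deg<-*ₚ zero    b {x ∷ p} {q} d _ = ≋[]⇒Deg< (*ₚ-zeroˡ q (Deg<0⇒≋[] d))
Deg<-*ₚ (suc a) b {x ∷ p} {q} d d′ =
  Deg<-+ₚ (Deg<-mono (s≤s (m≤n+m b a)) (scale-Deg< x d′))
          (divX-Deg< (Deg<-*ₚ a b (Deg<-divX d) d′))
  where
  scale-Deg< : ∀ {n q} x → Deg< n q → Deg< n (scale x q)
  scale-Deg< true  d = d
  scale-Deg< false d = deg< λ _ _ → refl

Deg<-∘ₚ : ∀ d k {c h} → Deg< (suc k) c → Deg< (suc d) h → Deg< (suc (d * k)) (c ∘ₚ h)
Deg<-∘ₚ d k       {[]}    _ _ = deg< λ _ _ → refl
Deg<-∘ₚ d zero    {x ∷ c} {h} dc dh =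
  Deg<-+ₚ (Deg<-mono (s≤s z≤n) (Deg<-length (constant x)))
          (≋[]⇒Deg< (≋-trans (*ₚ-congʳ h (∘ₚ-zeroˡ h (Deg<0⇒≋[] (Deg<-divX dc))))
                              (*ₚ-zeroʳ h)))
Deg<-∘ₚ d (suc k) {x ∷ c} {h} dc dh =
  Deg<-+ₚ (Deg<-mono (s≤s z≤n) (Deg<-length (constant x)))
          (subst (λ n → Deg< (suc n) (h *ₚ (c ∘ₚ h))) (sym (*-suc d k))
                 (Deg<-*ₚ (suc d) (d * k) dh (Deg<-∘ₚ d k (Deg<-divX dc) dh)))

coeff-monomial*ₚ : ∀ s q j → coeff (monomial s *ₚ q) (s + j) ≡ coeff q j
coeff-monomial*ₚ zero    q j = ≋⇒≈ (*ₚ-identityˡ q) j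
coeff-monomial*ₚ (suc s) q j = coeff-monomial*ₚ s q j

Deg<-monomial*ₚ : ∀ s {n q} → Deg< n q → Deg< (s + n) (monomial s *ₚ q)
Deg<-monomial*ₚ zero    {q = q} d = Deg<-resp-≋ (≋-sym (*ₚ-identityˡ q)) d
Deg<-monomial*ₚ (suc s) d = deg< λ { (suc k) (s≤s le) → vanishes (Deg<-monomial*ₚ s d) k le }

monomial≋X^ₚ : ∀ k → monomial k ≋ X ^ₚ k
monomial≋X^ₚ zero    = ≋-refl
monomial≋X^ₚ (suc k) = ≋-trans (false∷≋X*ₚ (monomial k)) (*ₚ-congʳ X (monomial≋X^ₚ k))

-- Division by G

trimCons : Bool → Poly → Poly
trimCons b []       = if b then true ∷ [] else []
trimCons b (x ∷ xs) = b ∷ x ∷ xs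

trim-∷ : ∀ b p → trim (b ∷ p) ≡ trimCons b (trim p)
trim-∷ b p with trim p
... | []     = refl
... | x ∷ xs = refl

trim-≋ : ∀ p → trim p ≋ p
trim-≋ []      = ≋-refl
trim-≋ (b ∷ p) = ≋-trans (≡⇒≋ (trim-∷ b p)) (trimCons-≋ b (trim p) (trim-≋ p))
  where
  trimCons-≋ : ∀ b t {p} → t ≋ p → trimCons b t ≋ b ∷ p
  trimCons-≋ true  []       e = ∷-cong refl e
  trimCons-≋ false []       e = ≋-sym (∷-≋-[] refl (≋-sym e))
  trimCons-≋ b     (x ∷ xs) e = ∷-cong refl e

length-trim : ∀ n p → Deg< n p → length (trim p) ≤ n
length-trim n []      _ = z≤n
length-trim n (b ∷ p) d rewrite trim-∷ b p =
  lemma n b (trim p) (length-trim (pred n) p (Deg<-divX d)) (true⇒1≤n d)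
  where
  true⇒1≤n : ∀ {n b p} → Deg< n (b ∷ p) → b ≡ true → 1 ≤ n
  true⇒1≤n {zero}  d refl with () ← vanishes d 0 z≤n
  true⇒1≤n {suc n} _ _    = s≤s z≤n
  lemma : ∀ n b t → length t ≤ pred n → (b ≡ true → 1 ≤ n) → length (trimCons b t) ≤ n
  lemma n       true  []       _  1≤n = 1≤n refl
  lemma n       false []       _  _   = z≤n
  lemma (suc n) b     (x ∷ xs) le _   = s≤s le

LeadingOne : Poly → Set
LeadingOne t = ∀ s → length t ≡ suc s → coeff t s ≡ true

trim-LeadingOne : ∀ p → LeadingOne (trim p)
trim-LeadingOne []      s ()
trim-LeadingOne (b ∷ p) rewrite trim-∷ b p = lemma b (trim p) (trim-LeadingOne p)
  where
  lemma : ∀ b t → LeadingOne t → LeadingOne (trimCons b t)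
  lemma true  []       _  zero    refl = refl
  lemma b     (x ∷ xs) l1 (suc s) e    = l1 s (suc-injective e)

divStep : ℕ → Poly → Poly × Poly
divStep k t = if length t <ᵇ 5 then ([] , t) else
  (monomial s +ₚ proj₁ (divmodG k t′) , proj₂ (divmodG k t′))
  where
  s = length t ∸ 5
  t′ = t +ₚ monomial s *ₚ Gp

divmodG-suc : ∀ k p → divmodG (suc k) p ≡ divStep k (trim p)
divmodG-suc k p with trim p
... | t with length t <ᵇ 5
...   | true  = refl
...   | false = refl

divmodG-correct : ∀ k p → p ≋ proj₁ (divmodG k p) *ₚ Gp +ₚ proj₂ (divmodG k p)
divmodG-correct zero    p = ≋-sym (trim-≋ p)
divmodG-correct (suc k) p rewrite divmodG-suc k p = ≋-trans (≋-sym (trim-≋ p)) (step (trim p))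
  where
  open ≋-Reasoning
  step : ∀ t → t ≋ proj₁ (divStep k t) *ₚ Gp +ₚ proj₂ (divStep k t)
  step t with length t <ᵇ 5
  ... | true  = ≋-refl
  ... | false = begin
    t
      ≈⟨ solve 2 (λ T M → T ⊜ ((T ⊕ M) ⊕ (⊝ M))) ≋-refl t M ⟩
    (t +ₚ M) +ₚ M
      ≈⟨ +ₚ-cong (divmodG-correct k (t +ₚ M)) (≋-refl {M}) ⟩
    (Q *ₚ Gp +ₚ R) +ₚ M
      ≈⟨ solve 4 (λ Q G R N → ((Q ⊗ G ⊕ R) ⊕ N ⊗ G) ⊜ ((N ⊕ Q) ⊗ G ⊕ R))
           ≋-refl Q Gp R (monomial s) ⟩
    (monomial s +ₚ Q) *ₚ Gp +ₚ R ∎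
    where
    s = length t ∸ 5
    M = monomial s *ₚ Gp
    Q = proj₁ (divmodG k (t +ₚ M))
    R = proj₂ (divmodG k (t +ₚ M))

-- G is monic of degree 4, so cancelling the leading term lowers the degree
Deg<-cancelLeading : ∀ t → LeadingOne t → 5 ≤ length t →
  Deg< (length t ∸ 5 + 4) (t +ₚ monomial (length t ∸ 5) *ₚ Gp)
Deg<-cancelLeading t l1 5≤len = deg< vanish
  where
  s = length t ∸ 5
  len≡ : length t ≡ suc (s + 4)
  len≡ = trans (sym (m∸n+n≡m 5≤len)) (+-suc s 4)
  vanish : ∀ k → s + 4 ≤ k → coeff (t +ₚ monomial s *ₚ Gp) k ≡ false
  vanish k le rewrite coeff-+ₚ t (monomial s *ₚ Gp) k with m≤n⇒m<n∨m≡n le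
  ... | inj₂ refl = cong₂ _xor_ (l1 (s + 4) len≡) (coeff-monomial*ₚ s Gp 4)
  ... | inj₁ lt   = cong₂ _xor_
    (vanishes (Deg<-length t) k (subst (_≤ k) (sym len≡) lt))
    (vanishes (Deg<-monomial*ₚ s (Deg<-length Gp)) k (subst (_≤ k) (sym (+-suc s 4)) lt))

Deg<-remainder : ∀ k p → length (trim p) ≤ k + 4 → Deg< 4 (proj₂ (divmodG k p))
Deg<-remainder zero    p le = Deg<-mono le (Deg<-length (trim p))
Deg<-remainder (suc k) p le rewrite divmodG-suc k p = step (trim p) (trim-LeadingOne p) le
  where
  step : ∀ t → LeadingOne t → length t ≤ suc k + 4 → Deg< 4 (proj₂ (divStep k t))
  step t l1 le with length t <ᵇ 5 in eq
  ... | true  = Deg<-mono (<⇒≤pred (<ᵇ⇒< (length t) 5 (subst T (sym eq) tt))) (Deg<-length t)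
  ... | false = Deg<-remainder k (t +ₚ monomial s *ₚ Gp)
      (≤-trans (length-trim (s + 4) _ (Deg<-cancelLeading t l1 5≤len)) (+-monoˡ-≤ 4 s≤k))
    where
    s = length t ∸ 5
    5≤len : 5 ≤ length t
    5≤len = ≮⇒≥ λ len<5 → subst T eq (<⇒<ᵇ len<5)
    s≤k : s ≤ k
    s≤k = ≤-trans (∸-monoˡ-≤ 5 le) (≤-reflexive (cong (_∸ 5) (+-comm (suc k) 4)))

coeff-*ₚGp : ∀ q k → coeff (q *ₚ Gp) (4 + k) ≡ coeff q (suc k) xor coeff q k
coeff-*ₚGp q k =
  trans (≋⇒≈ (*ₚ-comm q Gp) (4 + k))
  (trans (coeff-+ₚ q (false ∷ q +ₚ (false ∷ [])) (suc k))
  (cong (coeff q (suc k) xor_)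
    (≋⇒≈ (≋-trans (+ₚ-cong (≋-refl {q}) (∷-≋-[] refl ≋-refl)) (+ₚ-identityʳ q)) k)))

-- G = r³ + r⁴, so the coefficients of q above degree j are all equal, hence zero.
Deg<-quotient : ∀ j {q r} → Deg< 4 r → Deg< (j + 4) (q *ₚ Gp +ₚ r) → Deg< j q
Deg<-quotient j {q} {r} dr dqr = deg< λ k j≤k →
  trans (eventuallyConstant (length q) j≤k) (vanishes (Deg<-length q) (length q + k) (m≤m+n _ k))
  where
  xor≡false⇒≡ : ∀ {a b} → a xor b ≡ false → a ≡ b
  xor≡false⇒≡ {true}  {true}  _ = refl
  xor≡false⇒≡ {false} {false} _ = refl
  next : ∀ {k} → j ≤ k → coeff q k ≡ coeff q (suc k)
  next {k} j≤k = sym (xor≡false⇒≡ (trans (sym coeff-4+k)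
    (vanishes dqr (4 + k) (subst (_≤ 4 + k) (+-comm 4 j) (+-monoʳ-≤ 4 j≤k)))))
    where
    coeff-4+k : coeff (q *ₚ Gp +ₚ r) (4 + k) ≡ coeff q (suc k) xor coeff q k
    coeff-4+k = trans (coeff-+ₚ (q *ₚ Gp) r (4 + k))
      (trans (cong₂ _xor_ (coeff-*ₚGp q k) (vanishes dr (4 + k) (m≤m+n 4 k))) (xor-identityʳ _))
  eventuallyConstant : ∀ d {k} → j ≤ k → coeff q k ≡ coeff q (d + k)
  eventuallyConstant zero    _   = refl
  eventuallyConstant (suc d) {k} j≤k = trans (next j≤k)
    (trans (eventuallyConstant d (m≤n⇒m≤1+n j≤k)) (cong (coeff q) (+-suc d k)))

hornerG : List Poly → Poly
hornerG []       = []
hornerG (c ∷ cs) = c +ₚ Gp *ₚ hornerG cs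

gadic-correct : ∀ k p → Deg< (4 * k) p → p ≋ hornerG (gadic k p) × All (Deg< 4) (gadic k p)
gadic-correct zero    p d = Deg<0⇒≋[] d , []
gadic-correct (suc k) p d = p≋ , dr ∷ proj₂ ih
  where
  open ≋-Reasoning
  q = proj₁ (divmodG (length p) p)
  r = proj₂ (divmodG (length p) p)
  dr : Deg< 4 r
  dr = Deg<-remainder (length p) p (≤-trans (length-trim (length p) p (Deg<-length p)) (m≤m+n _ 4))
  dqr : Deg< (4 * k + 4) (q *ₚ Gp +ₚ r)
  dqr = subst (λ n → Deg< n (q *ₚ Gp +ₚ r)) (trans (*-suc 4 k) (+-comm 4 (4 * k)))
              (Deg<-resp-≋ (divmodG-correct (length p) p) d)
  ih = gadic-correct k q (Deg<-quotient (4 * k) dr dqr)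
  p≋ : p ≋ r +ₚ Gp *ₚ hornerG (gadic k q)
  p≋ = begin
    p                              ≈⟨ divmodG-correct (length p) p ⟩
    q *ₚ Gp +ₚ r                   ≈⟨ +ₚ-comm (q *ₚ Gp) r ⟩
    r +ₚ q *ₚ Gp                   ≈⟨ +ₚ-cong (≋-refl {r}) (*ₚ-comm q Gp) ⟩
    r +ₚ Gp *ₚ q                   ≈⟨ +ₚ-cong (≋-refl {r}) (*ₚ-congʳ Gp (proj₁ ih)) ⟩
    r +ₚ Gp *ₚ hornerG (gadic k q) ∎

-- Coordinates over Z/2[G]

record ∀₄ (P : ℕ → Set) : Set where
  constructor ⟨_,_,_,_⟩
  field get₀ : P 0
        get₁ : P 1
        get₂ : P 2
        get₃ : P 3
open ∀₄ public

all₄ : ∀ {P : ℕ → Set} → (∀ i → P i) → ∀₄ P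
all₄ p = ⟨ p 0 , p 1 , p 2 , p 3 ⟩

∀₄-map : ∀ {P Q : ℕ → Set} → (∀ {i} → P i → Q i) → ∀₄ P → ∀₄ Q
∀₄-map f ⟨ x₀ , x₁ , x₂ , x₃ ⟩ = ⟨ f x₀ , f x₁ , f x₂ , f x₃ ⟩

∀₄-zipWith : ∀ {P Q R : ℕ → Set} →
  (∀ {i} → P i → Q i → R i) → ∀₄ P → ∀₄ Q → ∀₄ R
∀₄-zipWith f ⟨ x₀ , x₁ , x₂ , x₃ ⟩ ⟨ y₀ , y₁ , y₂ , y₃ ⟩ =
  ⟨ f x₀ y₀ , f x₁ y₁ , f x₂ y₂ , f x₃ y₃ ⟩

Σ₄ : (ℕ → Poly) → Poly
Σ₄ f = f 0 +ₚ f 1 +ₚ f 2 +ₚ f 3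

Σ₄-cong : ∀ {f g} → ∀₄ (λ i → f i ≋ g i) → Σ₄ f ≋ Σ₄ g
Σ₄-cong ⟨ e₀ , e₁ , e₂ , e₃ ⟩ = +ₚ-cong (+ₚ-cong (+ₚ-cong e₀ e₁) e₂) e₃

expandG : (ℕ → Poly) → Poly
expandG a = Σ₄ λ i → (a i ∘ₚ Gp) *ₚ X ^ₚ i

lowPoly : (ℕ → Bool) → Poly
lowPoly b = Σ₄ λ i → constant (b i) *ₚ X ^ₚ i

bits≋lowPoly : ∀ b → b 0 ∷ b 1 ∷ b 2 ∷ b 3 ∷ [] ≋ lowPoly b
bits≋lowPoly b = begin
  b 0 ∷ b 1 ∷ b 2 ∷ b 3 ∷ []
    ≈⟨ ∷≋constant+X*ₚ (b 0) (b 1 ∷ b 2 ∷ b 3 ∷ []) ⟩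
  B 0 +ₚ X *ₚ (b 1 ∷ b 2 ∷ b 3 ∷ [])
    ≈⟨ +ₚ-cong (≋-refl {B 0}) (*ₚ-congʳ X (≋-trans
         (∷≋constant+X*ₚ (b 1) (b 2 ∷ b 3 ∷ []))
         (+ₚ-cong (≋-refl {B 1}) (*ₚ-congʳ X (∷≋constant+X*ₚ (b 2) (b 3 ∷ [])))))) ⟩
  B 0 +ₚ X *ₚ (B 1 +ₚ X *ₚ (B 2 +ₚ X *ₚ (b 3 ∷ [])))
    ≈⟨ solve 5 (λ B₀ B₁ B₂ B₃ x →
           (B₀ ⊕ x ⊗ (B₁ ⊕ x ⊗ (B₂ ⊕ x ⊗ B₃)))
           ⊜ (B₀ ⊗ (x ⊛ 0) ⊕ B₁ ⊗ (x ⊛ 1) ⊕ B₂ ⊗ (x ⊛ 2) ⊕ B₃ ⊗ (x ⊛ 3)))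
         ≋-refl (B 0) (B 1) (B 2) (B 3) X ⟩
  lowPoly b ∎
  where
  open ≋-Reasoning
  B : ℕ → Poly
  B i = constant (b i)

≋lowPoly : ∀ {c} → Deg< 4 c → c ≋ lowPoly (coeff c)
≋lowPoly {c} d = ≋-trans (≈⇒≋ coeffs) (bits≋lowPoly (coeff c))
  where
  coeffs : c ≈ coeff c 0 ∷ coeff c 1 ∷ coeff c 2 ∷ coeff c 3 ∷ []
  coeffs 0 = refl
  coeffs 1 = refl
  coeffs 2 = refl
  coeffs 3 = refl
  coeffs (suc (suc (suc (suc k)))) = vanishes d _ (s≤s (s≤s (s≤s (s≤s z≤n))))

lowPoly≋[] : ∀ {b} → lowPoly b ≋ [] → ∀₄ (λ i → b i ≡ false)
lowPoly≋[] {b} e = ⟨ bits 0 , bits 1 , bits 2 , bits 3 ⟩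
  where
  bits : b 0 ∷ b 1 ∷ b 2 ∷ b 3 ∷ [] ≈ []
  bits = ≋⇒≈ (≋-trans (bits≋lowPoly b) e)

Deg<-lowPoly : ∀ b → Deg< 4 (lowPoly b)
Deg<-lowPoly b = Deg<-resp-≋ (bits≋lowPoly b) (Deg<-length _)

expandG-cong : ∀ {a b} → ∀₄ (λ i → a i ≋ b i) → expandG a ≋ expandG b
expandG-cong {a} {b} ⟨ e₀ , e₁ , e₂ , e₃ ⟩ =
  Σ₄-cong {λ i → (a i ∘ₚ Gp) *ₚ X ^ₚ i} {λ i → (b i ∘ₚ Gp) *ₚ X ^ₚ i}
    ⟨ term 0 e₀ , term 1 e₁ , term 2 e₂ , term 3 e₃ ⟩
  where
  term : ∀ i {p q} → p ≋ q → (p ∘ₚ Gp) *ₚ X ^ₚ i ≋ (q ∘ₚ Gp) *ₚ X ^ₚ i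
  term i e = *ₚ-congˡ (X ^ₚ i) (∘ₚ-congˡ Gp e)

expandG-∷ : ∀ b d → expandG (λ i → b i ∷ d i) ≋ lowPoly b +ₚ Gp *ₚ expandG d
expandG-∷ b d =
  solve 9 (λ B₀ B₁ B₂ B₃ D₀ D₁ D₂ D₃ g →
    ((B₀ ⊕ g ⊗ D₀) ⊗ (Ι ⊛ 0) ⊕ (B₁ ⊕ g ⊗ D₁) ⊗ (Ι ⊛ 1)
       ⊕ (B₂ ⊕ g ⊗ D₂) ⊗ (Ι ⊛ 2) ⊕ (B₃ ⊕ g ⊗ D₃) ⊗ (Ι ⊛ 3))
    ⊜ ((B₀ ⊗ (Ι ⊛ 0) ⊕ B₁ ⊗ (Ι ⊛ 1) ⊕ B₂ ⊗ (Ι ⊛ 2) ⊕ B₃ ⊗ (Ι ⊛ 3))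
       ⊕ g ⊗ (D₀ ⊗ (Ι ⊛ 0) ⊕ D₁ ⊗ (Ι ⊛ 1) ⊕ D₂ ⊗ (Ι ⊛ 2) ⊕ D₃ ⊗ (Ι ⊛ 3))))
    ≋-refl (B 0) (B 1) (B 2) (B 3) (D 0) (D 1) (D 2) (D 3) Gp
  where
  B : ℕ → Poly
  B i = constant (b i)
  D : ℕ → Poly
  D i = d i ∘ₚ Gp
  Ι : ∀ {n} → Expr Poly n
  Ι = Κ X

expandG-divX : ∀ a →
  expandG a ≋ lowPoly (λ i → coeff₀ (a i)) +ₚ Gp *ₚ expandG (λ i → divX (a i))
expandG-divX a = ≋-trans
  (expandG-cong {a} {λ i → coeff₀ (a i) ∷ divX (a i)} (all₄ λ i → ≋-coeff₀∷divX (a i)))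
  (expandG-∷ (λ i → coeff₀ (a i)) (λ i → divX (a i)))

Σ₄-+ₚ : ∀ f g → Σ₄ f +ₚ Σ₄ g ≋ Σ₄ (λ i → f i +ₚ g i)
Σ₄-+ₚ f g = solve 8 (λ f₀ f₁ f₂ f₃ g₀ g₁ g₂ g₃ →
    ((f₀ ⊕ f₁ ⊕ f₂ ⊕ f₃) ⊕ (g₀ ⊕ g₁ ⊕ g₂ ⊕ g₃))
    ⊜ ((f₀ ⊕ g₀) ⊕ (f₁ ⊕ g₁) ⊕ (f₂ ⊕ g₂) ⊕ (f₃ ⊕ g₃)))
  ≋-refl (f 0) (f 1) (f 2) (f 3) (g 0) (g 1) (g 2) (g 3)

expandG-+ₚ : ∀ a b → expandG a +ₚ expandG b ≋ expandG (λ i → a i +ₚ b i)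
expandG-+ₚ a b = ≋-trans (Σ₄-+ₚ (A a) (A b)) (Σ₄-cong (all₄ term))
  where
  A : (ℕ → Poly) → ℕ → Poly
  A c i = (c i ∘ₚ Gp) *ₚ X ^ₚ i
  term : ∀ i → A a i +ₚ A b i ≋ A (λ j → a j +ₚ b j) i
  term i = ≋-sym (≋-trans (*ₚ-congˡ (X ^ₚ i) (∘ₚ-+ₚ (a i) (b i) Gp))
                          (*ₚ-distribʳ (X ^ₚ i) (a i ∘ₚ Gp) (b i ∘ₚ Gp)))

digits : ℕ → List Poly → Poly
digits i = map (λ c → coeff c i)

hornerG≋expandG : ∀ {cs} → All (Deg< 4) cs → hornerG cs ≋ expandG (λ i → digits i cs)
hornerG≋expandG {[]}     []       = ≋-refl
hornerG≋expandG {c ∷ cs} (d ∷ ds) = begin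
  c +ₚ Gp *ₚ hornerG cs
    ≈⟨ +ₚ-cong (≋lowPoly d) (*ₚ-congʳ Gp (hornerG≋expandG ds)) ⟩
  lowPoly (coeff c) +ₚ Gp *ₚ expandG (λ i → digits i cs)
    ≈⟨ ≋-sym (expandG-∷ (coeff c) (λ i → digits i cs)) ⟩
  expandG (λ i → digits i (c ∷ cs)) ∎
  where open ≋-Reasoning

coord-correct : ∀ p → p ≋ expandG (coord p)
coord-correct p = ≋-trans (proj₁ gadic-p) (hornerG≋expandG (proj₂ gadic-p))
  where
  gadic-p = gadic-correct (suc (length p)) p
    (Deg<-mono (≤-trans (n≤1+n (length p)) (m≤n*m (suc (length p)) 4)) (Deg<-length p))

expandG≋quotient : ∀ a →
  expandG a ≋ expandG (λ i → divX (a i)) *ₚ Gp +ₚ lowPoly (λ i → coeff₀ (a i))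
expandG≋quotient a = ≋-trans (expandG-divX a)
  (≋-trans (+ₚ-comm (lowPoly h) (Gp *ₚ S)) (+ₚ-cong (*ₚ-comm Gp S) (≋-refl {lowPoly h})))
  where
  h = λ i → coeff₀ (a i)
  S = expandG (λ i → divX (a i))

-- The fuel bounds the lengths of the coordinates, so that the case k = 0 terminates.
expandG-Deg< : ∀ fuel k {a} → ∀₄ (λ i → Deg< fuel (a i)) → Deg< (4 * k) (expandG a) →
  ∀₄ (λ i → Deg< k (a i))
expandG-Deg< zero       k       da _  = ∀₄-map (Deg<-mono z≤n) da
expandG-Deg< (suc fuel) (suc k) {a} da dE =
  ∀₄-map divX-Deg<
    (expandG-Deg< fuel k (∀₄-map Deg<-divX da) (Deg<-quotient (4 * k) (Deg<-lowPoly h) dSGL))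
  where
  h = λ i → coeff₀ (a i)
  SGL = expandG (λ i → divX (a i)) *ₚ Gp +ₚ lowPoly h
  dSGL : Deg< (4 * k + 4) SGL
  dSGL = subst (λ n → Deg< n SGL) (trans (*-suc 4 k) (+-comm 4 (4 * k)))
           (Deg<-resp-≋ (expandG≋quotient a) dE)
expandG-Deg< (suc fuel) zero    {a} da dE =
  ∀₄-zipWith (λ hᵢ≡false dtᵢ →
      ≋[]⇒Deg< (≋-trans (≋-coeff₀∷divX _) (∷-≋-[] hᵢ≡false (Deg<0⇒≋[] dtᵢ))))
    (lowPoly≋[] L≋[]) dt
  where
  open ≋-Reasoning
  h = λ i → coeff₀ (a i)
  S = expandG (λ i → divX (a i))
  dt : ∀₄ (λ i → Deg< 0 (divX (a i)))
  dt = expandG-Deg< fuel 0 (∀₄-map Deg<-divX da)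
         (Deg<-quotient 0 (Deg<-lowPoly h) (Deg<-mono z≤n (Deg<-resp-≋ (expandG≋quotient a) dE)))
  L≋[] : lowPoly h ≋ []
  L≋[] = begin
    lowPoly h
      ≈⟨ +ₚ-cong (*ₚ-congˡ Gp (≋-sym (expandG-cong (∀₄-map Deg<0⇒≋[] dt))))
                 (≋-refl {lowPoly h}) ⟩
    S *ₚ Gp +ₚ lowPoly h
      ≈⟨ ≋-sym (expandG≋quotient a) ⟩
    expandG a
      ≈⟨ Deg<0⇒≋[] dE ⟩
    [] ∎

maxLength₄ : (ℕ → Poly) → ℕ
maxLength₄ a = length (a 0) ⊔ length (a 1) ⊔ length (a 2) ⊔ length (a 3)

Deg<-maxLength₄ : ∀ a → ∀₄ (λ i → Deg< (maxLength₄ a) (a i))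
Deg<-maxLength₄ a = ⟨ Deg<-mono l₀≤ (Deg<-length (a 0)) , Deg<-mono l₁≤ (Deg<-length (a 1))
                     , Deg<-mono l₂≤ (Deg<-length (a 2)) , Deg<-mono l₃≤ (Deg<-length (a 3)) ⟩
  where
  l : ℕ → ℕ
  l i = length (a i)
  l₀≤ = ≤-trans (≤-trans (m≤m⊔n (l 0) (l 1)) (m≤m⊔n _ (l 2))) (m≤m⊔n _ (l 3))
  l₁≤ = ≤-trans (≤-trans (m≤n⊔m (l 0) (l 1)) (m≤m⊔n _ (l 2))) (m≤m⊔n _ (l 3))
  l₂≤ = ≤-trans (m≤n⊔m (l 0 ⊔ l 1) (l 2)) (m≤m⊔n _ (l 3))
  l₃≤ = m≤n⊔m (l 0 ⊔ l 1 ⊔ l 2) (l 3)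

coord-unique : ∀ {p} a → p ≋ expandG a → ∀₄ (λ i → coord p i ≋ a i)
coord-unique {p} a p≋ = ∀₄-map (+ₚ≋[]⇒≋ ∘ Deg<0⇒≋[])
  (expandG-Deg< _ 0 (Deg<-maxLength₄ (λ i → coord p i +ₚ a i)) (≋[]⇒Deg< sum≋[]))
  where
  open ≋-Reasoning
  sum≋[] : expandG (λ i → coord p i +ₚ a i) ≋ []
  sum≋[] = begin
    expandG (λ i → coord p i +ₚ a i)      ≈⟨ ≋-sym (expandG-+ₚ (coord p) a) ⟩
    expandG (coord p) +ₚ expandG a        ≈⟨ +ₚ-cong (≋-sym (coord-correct p)) (≋-sym p≋) ⟩
    p +ₚ p                                ≈⟨ +ₚ-self p ⟩
    []                                    ∎

coord-Deg< : ∀ k {p} → Deg< (4 * k) p → ∀₄ (λ i → Deg< k (coord p i))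
coord-Deg< k {p} d = expandG-Deg< _ k (Deg<-maxLength₄ (coord p)) (Deg<-resp-≋ (coord-correct p) d)

-- The operator U

r+1 : Poly
r+1 = X +ₚ 1ₚ

∘ₚr+1-involutive : ∀ p → (p ∘ₚ r+1) ∘ₚ r+1 ≋ p
∘ₚr+1-involutive p = ≋-trans (∘ₚ-assoc p r+1 r+1)
  (≋-trans (∘ₚ-congʳ p (by-evaluation (r+1 ∘ₚ r+1) X)) (∘ₚ-X p))

∘ₚGp∘ₚr+1 : ∀ a → (a ∘ₚ Gp) ∘ₚ r+1 ≋ a ∘ₚ Fp
∘ₚGp∘ₚr+1 a = ≋-trans (∘ₚ-assoc a Gp r+1) (∘ₚ-congʳ a (by-evaluation (Gp ∘ₚ r+1) Fp))

∘ₚFp∘ₚr+1 : ∀ a → (a ∘ₚ Fp) ∘ₚ r+1 ≋ a ∘ₚ Gp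
∘ₚFp∘ₚr+1 a = ≋-trans (∘ₚ-assoc a Fp r+1) (∘ₚ-congʳ a (by-evaluation (Fp ∘ₚ r+1) Gp))

Σ₄-∘ₚ : ∀ f h → Σ₄ f ∘ₚ h ≋ Σ₄ (λ i → f i ∘ₚ h)
Σ₄-∘ₚ f h =
  ≋-trans (∘ₚ-+ₚ (f 0 +ₚ f 1 +ₚ f 2) (f 3) h)
  (+ₚ-cong (≋-trans (∘ₚ-+ₚ (f 0 +ₚ f 1) (f 2) h) (+ₚ-cong (∘ₚ-+ₚ (f 0) (f 1) h) ≋-refl))
           ≋-refl)

correction : Poly → Poly
correction h = coord h 1 +ₚ coord h 2 +ₚ coord h 3

-- (r+1)^i = U(r^i) + 1 for i = 1, 2, 3, so substituting r+1 agrees with U up to a correction.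
U-formula : ∀ h → U h ≋ h ∘ₚ r+1 +ₚ correction h ∘ₚ Fp
U-formula h = ≋-sym (begin
  h ∘ₚ r+1 +ₚ correction h ∘ₚ Fp
    ≈⟨ +ₚ-cong (∘ₚ-congˡ r+1 (coord-correct h))
               (≋-trans (∘ₚ-+ₚ (a 1 +ₚ a 2) (a 3) Fp)
                        (+ₚ-cong (∘ₚ-+ₚ (a 1) (a 2) Fp) (≋-refl {A 3}))) ⟩
  expandG a ∘ₚ r+1 +ₚ Σcorr
    ≈⟨ +ₚ-cong (≋-trans (Σ₄-∘ₚ Term r+1) (Σ₄-cong (all₄ term))) (≋-refl {Σcorr}) ⟩
  Σ₄ (λ i → A i *ₚ ((X ^ₚ i) ∘ₚ r+1)) +ₚ Σcorr
    ≈⟨ +ₚ-cong (Σ₄-cong {λ i → A i *ₚ ((X ^ₚ i) ∘ₚ r+1)} {λ i → A i *ₚ V i}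
                 ⟨ *ₚ-congʳ (A 0) (by-evaluation _ _) , *ₚ-congʳ (A 1) (by-evaluation _ _)
                 , *ₚ-congʳ (A 2) (by-evaluation _ _) , *ₚ-congʳ (A 3) (by-evaluation _ _) ⟩)
               (≋-refl {Σcorr}) ⟩
  Σ₄ (λ i → A i *ₚ V i) +ₚ Σcorr
    ≈⟨ solve 8 (λ A₀ A₁ A₂ A₃ U₀ U₁ U₂ U₃ →
         ((A₀ ⊗ U₀ ⊕ A₁ ⊗ (U₁ ⊕ Κ 1ₚ) ⊕ A₂ ⊗ (U₂ ⊕ Κ 1ₚ) ⊕ A₃ ⊗ (U₃ ⊕ Κ 1ₚ))
          ⊕ (A₁ ⊕ A₂ ⊕ A₃))
         ⊜ (A₀ ⊗ U₀ ⊕ A₁ ⊗ U₁ ⊕ A₂ ⊗ U₂ ⊕ A₃ ⊗ U₃)) ≋-refl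
         (A 0) (A 1) (A 2) (A 3) (Ubasis 0) (Ubasis 1) (Ubasis 2) (Ubasis 3) ⟩
  U h ∎)
  where
  open ≋-Reasoning
  a = coord h
  A : ℕ → Poly
  A i = a i ∘ₚ Fp
  Σcorr = A 1 +ₚ A 2 +ₚ A 3
  V : ℕ → Poly
  V 0 = Ubasis 0
  V i = Ubasis i +ₚ 1ₚ
  Term : ℕ → Poly
  Term i = (a i ∘ₚ Gp) *ₚ X ^ₚ i
  term : ∀ i → Term i ∘ₚ r+1 ≋ A i *ₚ ((X ^ₚ i) ∘ₚ r+1)
  term i = ≋-trans (∘ₚ-*ₚ (a i ∘ₚ Gp) (X ^ₚ i) r+1) (*ₚ-congˡ _ (∘ₚGp∘ₚr+1 (a i)))

correction-+ₚ : ∀ p q → correction (p +ₚ q) ≋ correction p +ₚ correction q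
correction-+ₚ p q = ≋-trans (+ₚ-cong (+ₚ-cong (get₁ coords) (get₂ coords)) (get₃ coords))
  (solve 6 (λ a b c d e f → ((a ⊕ d) ⊕ (b ⊕ e) ⊕ (c ⊕ f)) ⊜ ((a ⊕ b ⊕ c) ⊕ (d ⊕ e ⊕ f)))
     ≋-refl
     (coord p 1) (coord p 2) (coord p 3) (coord q 1) (coord q 2) (coord q 3))
  where
  coords = coord-unique (λ i → coord p i +ₚ coord q i)
             (≋-trans (+ₚ-cong (coord-correct p) (coord-correct q)) (expandG-+ₚ (coord p) (coord q)))

U-+ₚ : ∀ p q → U (p +ₚ q) ≋ U p +ₚ U q
U-+ₚ p q = begin
  U (p +ₚ q)
    ≈⟨ U-formula (p +ₚ q) ⟩
  (p +ₚ q) ∘ₚ r+1 +ₚ correction (p +ₚ q) ∘ₚ Fp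
    ≈⟨ +ₚ-cong (∘ₚ-+ₚ p q r+1) (≋-trans (∘ₚ-congˡ Fp (correction-+ₚ p q))
                                         (∘ₚ-+ₚ (correction p) (correction q) Fp)) ⟩
  (p ∘ₚ r+1 +ₚ q ∘ₚ r+1) +ₚ (correction p ∘ₚ Fp +ₚ correction q ∘ₚ Fp)
    ≈⟨ +ₚ-interchange (p ∘ₚ r+1) (q ∘ₚ r+1) (correction p ∘ₚ Fp) (correction q ∘ₚ Fp) ⟩
  (p ∘ₚ r+1 +ₚ correction p ∘ₚ Fp) +ₚ (q ∘ₚ r+1 +ₚ correction q ∘ₚ Fp)
    ≈⟨ +ₚ-cong (≋-sym (U-formula p)) (≋-sym (U-formula q)) ⟩
  U p +ₚ U q ∎
  where open ≋-Reasoning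

U+I²-formula : ∀ f → U+I (U+I f) ≋ correction f ∘ₚ Gp +ₚ correction (U f) ∘ₚ Fp
U+I²-formula f = begin
  U (U f +ₚ f) +ₚ (U f +ₚ f)
    ≈⟨ +ₚ-cong (≋-trans (U-+ₚ (U f) f) (+ₚ-cong U²f (≋-refl {U f}))) (≋-refl {U f +ₚ f}) ⟩
  ((f +ₚ c ∘ₚ Gp) +ₚ d ∘ₚ Fp +ₚ U f) +ₚ (U f +ₚ f)
    ≈⟨ solve 4 (λ f C D u → ((((f ⊕ C) ⊕ D) ⊕ u) ⊕ (⊝ u ⊕ ⊝ f)) ⊜ (C ⊕ D))
         ≋-refl f (c ∘ₚ Gp) (d ∘ₚ Fp) (U f) ⟩
  c ∘ₚ Gp +ₚ d ∘ₚ Fp ∎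
  where
  open ≋-Reasoning
  c = correction f
  d = correction (U f)
  U²f : U (U f) ≋ (f +ₚ c ∘ₚ Gp) +ₚ d ∘ₚ Fp
  U²f = begin
    U (U f)
      ≈⟨ U-formula (U f) ⟩
    U f ∘ₚ r+1 +ₚ d ∘ₚ Fp
      ≈⟨ +ₚ-cong (∘ₚ-congˡ r+1 (U-formula f)) (≋-refl {d ∘ₚ Fp}) ⟩
    (f ∘ₚ r+1 +ₚ c ∘ₚ Fp) ∘ₚ r+1 +ₚ d ∘ₚ Fp
      ≈⟨ +ₚ-cong (≋-trans (∘ₚ-+ₚ (f ∘ₚ r+1) (c ∘ₚ Fp) r+1)
                          (+ₚ-cong (∘ₚr+1-involutive f) (∘ₚFp∘ₚr+1 c))) (≋-refl {d ∘ₚ Fp}) ⟩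
    (f +ₚ c ∘ₚ Gp) +ₚ d ∘ₚ Fp ∎

-- Order of vanishing at r = 0

record VanishesBelow (k : ℕ) (p : Poly) : Set where
  constructor vanishesBelow
  field vanishes-< : ∀ j → j < k → coeff p j ≡ false
open VanishesBelow public

coeff-drop : ∀ k p j → coeff (drop k p) j ≡ coeff p (k + j)
coeff-drop zero    p       j = refl
coeff-drop (suc k) []      j = refl
coeff-drop (suc k) (b ∷ p) j = coeff-drop k p j

≋monomial*ₚdrop : ∀ k p → VanishesBelow k p → p ≋ monomial k *ₚ drop k p
≋monomial*ₚdrop zero    p v = ≋-sym (*ₚ-identityˡ p)
≋monomial*ₚdrop (suc k) []      v = ≋-sym (*ₚ-zeroʳ (monomial (suc k)))
≋monomial*ₚdrop (suc k) (b ∷ p) v = ∷-cong (vanishes-< v 0 (s≤s z≤n))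
  (≋monomial*ₚdrop k p (vanishesBelow λ j j<k → vanishes-< v (suc j) (s≤s j<k)))

VanishesBelow-suc : ∀ {k p} → VanishesBelow k p → coeff p k ≡ false → VanishesBelow (suc k) p
VanishesBelow-suc {k} {p} v pₖ≡false = vanishesBelow below
  where
  below : ∀ j → j < suc k → coeff p j ≡ false
  below j (s≤s j≤k) with m≤n⇒m<n∨m≡n j≤k
  ... | inj₁ j<k  = vanishes-< v j j<k
  ... | inj₂ refl = pₖ≡false

coeff₀-*ₚ : ∀ p q → coeff₀ (p *ₚ q) ≡ coeff₀ p ∧ coeff₀ q
coeff₀-*ₚ []          q = refl
coeff₀-*ₚ (true ∷ p)  q = trans (coeff-+ₚ q (false ∷ p *ₚ q) 0) (xor-identityʳ _)
coeff₀-*ₚ (false ∷ p) q = refl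

coeff₀-∘ₚ : ∀ d {h} → coeff₀ h ≡ false → coeff₀ (d ∘ₚ h) ≡ coeff₀ d
coeff₀-∘ₚ []      _  = refl
coeff₀-∘ₚ (b ∷ d) {h} h₀≡false = trans (coeff-+ₚ (constant b) (h *ₚ (d ∘ₚ h)) 0)
  (trans (cong (b xor_) (trans (coeff₀-*ₚ h (d ∘ₚ h)) (cong (_∧ coeff₀ (d ∘ₚ h)) h₀≡false)))
         (xor-identityʳ b))

coeff₀-^ₚ-true : ∀ {p} n → coeff₀ p ≡ true → coeff₀ (p ^ₚ n) ≡ true
coeff₀-^ₚ-true         zero    _  = refl
coeff₀-^ₚ-true {p} (suc n) p₀ =
  trans (coeff₀-*ₚ p (p ^ₚ n)) (cong₂ _∧_ p₀ (coeff₀-^ₚ-true n p₀))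

coeff₀-^ₚ-false : ∀ {p} n → coeff₀ p ≡ false → coeff₀ (p ^ₚ suc n) ≡ false
coeff₀-^ₚ-false {p} n p₀ = trans (coeff₀-*ₚ p (p ^ₚ n)) (cong (_∧ coeff₀ (p ^ₚ n)) p₀)

∘ₚX*ₚ≋monomial* : ∀ h k {d} → VanishesBelow k d →
  d ∘ₚ (X *ₚ h) ≋ monomial k *ₚ (h ^ₚ k *ₚ drop k d ∘ₚ (X *ₚ h))
∘ₚX*ₚ≋monomial* h k {d} v = begin
  d ∘ₚ Xh                          ≈⟨ ∘ₚ-congˡ Xh (≋monomial*ₚdrop k d v) ⟩
  (monomial k *ₚ e) ∘ₚ Xh          ≈⟨ ∘ₚ-*ₚ (monomial k) e Xh ⟩
  monomial k ∘ₚ Xh *ₚ e ∘ₚ Xh      ≈⟨ *ₚ-congˡ (e ∘ₚ Xh) (≋-trans (∘ₚ-congˡ Xh (monomial≋X^ₚ k))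
                                        (≋-trans (∘ₚ-^ₚ X k Xh) (^ₚ-cong k (X-∘ₚ Xh)))) ⟩
  Xh ^ₚ k *ₚ e ∘ₚ Xh               ≈⟨ *ₚ-congˡ (e ∘ₚ Xh) (^ₚ-*ₚ X h k) ⟩
  (X ^ₚ k *ₚ h ^ₚ k) *ₚ e ∘ₚ Xh    ≈⟨ *ₚ-assoc (X ^ₚ k) (h ^ₚ k) (e ∘ₚ Xh) ⟩
  X ^ₚ k *ₚ (h ^ₚ k *ₚ e ∘ₚ Xh)    ≈⟨ *ₚ-congˡ _ (≋-sym (monomial≋X^ₚ k)) ⟩
  monomial k *ₚ (h ^ₚ k *ₚ e ∘ₚ Xh) ∎
  where
  open ≋-Reasoning
  Xh = X *ₚ h
  e = drop k d

coeff-∘ₚX*ₚ : ∀ h k {d} → VanishesBelow k d →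
  coeff (d ∘ₚ (X *ₚ h)) k ≡ coeff₀ (h ^ₚ k) ∧ coeff d k
coeff-∘ₚX*ₚ h k {d} v = begin
  coeff (d ∘ₚ Xh) k                     ≡⟨ ≋⇒≈ (∘ₚX*ₚ≋monomial* h k v) k ⟩
  coeff (monomial k *ₚ R) k             ≡⟨ cong (coeff (monomial k *ₚ R)) (sym (+-identityʳ k)) ⟩
  coeff (monomial k *ₚ R) (k + 0)       ≡⟨ coeff-monomial*ₚ k R 0 ⟩
  coeff₀ (h ^ₚ k *ₚ e ∘ₚ Xh)            ≡⟨ coeff₀-*ₚ (h ^ₚ k) (e ∘ₚ Xh) ⟩
  coeff₀ (h ^ₚ k) ∧ coeff₀ (e ∘ₚ Xh)    ≡⟨ cong (coeff₀ (h ^ₚ k) ∧_) (coeff₀-∘ₚ e refl) ⟩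
  coeff₀ (h ^ₚ k) ∧ coeff (drop k d) 0  ≡⟨ cong (coeff₀ (h ^ₚ k) ∧_) (coeff-drop k d 0) ⟩
  coeff₀ (h ^ₚ k) ∧ coeff d (k + 0)     ≡⟨ cong (λ j → coeff₀ (h ^ₚ k) ∧ coeff d j) (+-identityʳ k) ⟩
  coeff₀ (h ^ₚ k) ∧ coeff d k           ∎
  where
  open ≡-Reasoning
  Xh = X *ₚ h
  e = drop k d
  R = h ^ₚ k *ₚ e ∘ₚ Xh

-- F = r·(r+1)³ with (r+1)³ a unit at r = 0, while G = r·r²(r+1): once the coefficients below
-- r^(k+1) of c and d vanish, comparing coefficients of r^(k+1) in c(G) = d(F) kills that of d.
∘ₚGp≋∘ₚFp⇒next : ∀ k {c d} → VanishesBelow (suc k) c → VanishesBelow (suc k) d →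
  c ∘ₚ Gp ≋ d ∘ₚ Fp → coeff d (suc k) ≡ false
∘ₚGp≋∘ₚFp⇒next k {c} {d} vc vd e = begin
  coeff d (suc k)
    ≡⟨ sym (cong (_∧ coeff d (suc k)) (coeff₀-^ₚ-true {r+1 ^ₚ 3} (suc k) refl)) ⟩
  coeff₀ ((r+1 ^ₚ 3) ^ₚ suc k) ∧ coeff d (suc k)
    ≡⟨ sym (coeff-∘ₚX*ₚ (r+1 ^ₚ 3) (suc k) vd) ⟩
  coeff (d ∘ₚ Fp) (suc k)
    ≡⟨ sym (≋⇒≈ e (suc k)) ⟩
  coeff (c ∘ₚ Gp) (suc k)
    ≡⟨ ≋⇒≈ (∘ₚ-congʳ c (by-evaluation Gp (X *ₚ r²r+1))) (suc k) ⟩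
  coeff (c ∘ₚ (X *ₚ r²r+1)) (suc k)
    ≡⟨ coeff-∘ₚX*ₚ r²r+1 (suc k) vc ⟩
  coeff₀ (r²r+1 ^ₚ suc k) ∧ coeff c (suc k)
    ≡⟨ cong (_∧ coeff c (suc k)) (coeff₀-^ₚ-false {r²r+1} k refl) ⟩
  false ∎
  where
  open ≡-Reasoning
  r²r+1 = X ^ₚ 2 *ₚ r+1

∘ₚGp≋∘ₚFp⇒≋[] : ∀ {c d} → coeff₀ c ≡ false → c ∘ₚ Gp ≋ d ∘ₚ Fp → c ≋ []
∘ₚGp≋∘ₚFp⇒≋[] {c} {d} c₀≡false e =
  ≈⇒≋ λ j → vanishes-< (proj₁ (vanish j)) j ≤-refl
  where
  e′ : d ∘ₚ Gp ≋ c ∘ₚ Fp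
  e′ = ≋-trans (≋-sym (∘ₚFp∘ₚr+1 d)) (≋-trans (∘ₚ-congˡ r+1 (≋-sym e)) (∘ₚGp∘ₚr+1 c))
  d₀≡false : coeff₀ d ≡ false
  d₀≡false = trans (sym (coeff₀-∘ₚ d refl))
    (trans (sym (≋⇒≈ e 0)) (trans (coeff₀-∘ₚ c refl) c₀≡false))
  below1 : ∀ {p} → coeff₀ p ≡ false → VanishesBelow 1 p
  below1 p₀≡false = vanishesBelow λ { zero _ → p₀≡false ; (suc j) (s≤s ()) }
  vanish : ∀ k → VanishesBelow (suc k) c × VanishesBelow (suc k) d
  vanish zero    = below1 c₀≡false , below1 d₀≡false
  vanish (suc k) with vanish k
  ... | vc , vd = VanishesBelow-suc vc (∘ₚGp≋∘ₚFp⇒next k vd vc e′)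
                , VanishesBelow-suc vd (∘ₚGp≋∘ₚFp⇒next k vc vd e)

-- The spaces L and L*

r² : Poly
r² = X ^ₚ 2

G² : Poly
G² = Gp *ₚ Gp

r²+r : Poly
r²+r = r² +ₚ X

fromBits : ∀ {k} → (Fin k → Bool) → Poly
fromBits f = toList (tabulate f)

coeff-fromBits : ∀ {k} (f : Fin k → Bool) i → coeff (fromBits f) (toℕ i) ≡ f i
coeff-fromBits f zero    = refl
coeff-fromBits f (suc i) = coeff-fromBits (f ∘ suc) i

Deg<-toList : ∀ {n} (xs : Vec Bool n) → Deg< n (toList xs)
Deg<-toList xs = subst (λ n → Deg< n (toList xs)) (length-toList xs) (Deg<-length (toList xs))

Deg<-fromBits : ∀ {k} (f : Fin k → Bool) → Deg< k (fromBits f)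
Deg<-fromBits f = Deg<-toList (tabulate f)

fromBits-coeff : ∀ n {p} → Deg< n p → fromBits (λ (i : Fin n) → coeff p (toℕ i)) ≋ p
fromBits-coeff zero    d = ≋-sym (Deg<0⇒≋[] d)
fromBits-coeff (suc n) {[]}    d = ∷-≋-[] refl (fromBits-coeff n {[]} (deg< λ _ _ → refl))
fromBits-coeff (suc n) {b ∷ p} d = ∷-cong refl (fromBits-coeff n (Deg<-divX d))

sumFin-cong : ∀ k {f g : Fin k → Poly} → (∀ i → f i ≋ g i) → sumFin k f ≋ sumFin k g
sumFin-cong zero    e = ≋-refl
sumFin-cong (suc k) e = +ₚ-cong (e zero) (sumFin-cong k (e ∘ suc))

sumFin-*ₚ : ∀ k q (f : Fin k → Poly) → q *ₚ sumFin k f ≋ sumFin k (λ i → q *ₚ f i)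
sumFin-*ₚ zero    q f = *ₚ-zeroʳ q
sumFin-*ₚ (suc k) q f =
  ≋-trans (*ₚ-distribˡ q (f zero) (sumFin k (f ∘ suc)))
          (+ₚ-cong ≋-refl (sumFin-*ₚ k q (f ∘ suc)))

sumFin-∘ₚ : ∀ k (f : Fin k → Poly) h → sumFin k f ∘ₚ h ≋ sumFin k (λ i → f i ∘ₚ h)
sumFin-∘ₚ zero    f h = ≋-refl
sumFin-∘ₚ (suc k) f h =
  ≋-trans (∘ₚ-+ₚ (f zero) (sumFin k (f ∘ suc)) h) (+ₚ-cong ≋-refl (sumFin-∘ₚ k (f ∘ suc) h))

Deg<-sumFin : ∀ k {n} {f : Fin k → Poly} → (∀ i → Deg< n (f i)) → Deg< n (sumFin k f)
Deg<-sumFin zero    d = deg< λ _ _ → refl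
Deg<-sumFin (suc k) d = Deg<-+ₚ (d zero) (Deg<-sumFin k (d ∘ suc))

digitTerm : ∀ {k} → Poly → Poly → Poly → Fin k → Poly
digitTerm a q h n = scale (coeff a (toℕ n)) (q *ₚ h ^ₚ toℕ n)

sumFin-digits : ∀ k a q h → Deg< k a → sumFin k (digitTerm a q h) ≋ q *ₚ (a ∘ₚ h)
sumFin-digits zero    a q h d =
  ≋-sym (≋-trans (*ₚ-congʳ q (∘ₚ-zeroˡ h (Deg<0⇒≋[] d))) (*ₚ-zeroʳ q))
sumFin-digits (suc k) a q h d = begin
  digitTerm {suc k} a q h zero +ₚ sumFin k (digitTerm a q h ∘ suc)
    ≈⟨ +ₚ-cong (scale≋constant*ₚ (coeff₀ a) (q *ₚ 1ₚ)) (sumFin-cong k shift) ⟩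
  c₀ *ₚ (q *ₚ 1ₚ) +ₚ sumFin k (digitTerm a′ (q *ₚ h) h)
    ≈⟨ +ₚ-cong (≋-refl {c₀ *ₚ (q *ₚ 1ₚ)}) (sumFin-digits k a′ (q *ₚ h) h (Deg<-divX d)) ⟩
  c₀ *ₚ (q *ₚ 1ₚ) +ₚ (q *ₚ h) *ₚ (a′ ∘ₚ h)
    ≈⟨ solve 4 (λ c q h t → (c ⊗ (q ⊗ Κ 1ₚ) ⊕ (q ⊗ h) ⊗ t) ⊜ (q ⊗ (c ⊕ h ⊗ t)))
         ≋-refl c₀ q h (a′ ∘ₚ h) ⟩
  q *ₚ ((coeff₀ a ∷ a′) ∘ₚ h)
    ≈⟨ *ₚ-congʳ q (∘ₚ-congˡ h (≋-sym (≋-coeff₀∷divX a))) ⟩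
  q *ₚ (a ∘ₚ h) ∎
  where
  open ≋-Reasoning
  c₀ = constant (coeff₀ a)
  a′ = divX a
  shift : ∀ n → digitTerm a q h (suc n) ≋ digitTerm a′ (q *ₚ h) h n
  shift n = ≋-trans (≡⇒≋ (cong (λ b → scale b (q *ₚ (h *ₚ h ^ₚ toℕ n))) (coeff-divX a (toℕ n))))
                    (scale-cong (coeff a′ (toℕ n)) (≋-sym (*ₚ-assoc q h (h ^ₚ toℕ n))))

combL≋ : ∀ m c (P : Fin 3 → Poly) → (∀ i → Deg< (suc m) (P i)) →
  (∀ i n → coeff (P i) (toℕ n) ≡ c i n) → combL m c ≋ sumFin 3 (λ i → u i *ₚ (P i ∘ₚ G²))
combL≋ m c P d coeffs = sumFin-cong 3 λ i →
  ≋-trans (sumFin-cong (suc m) λ n →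
             ≋-trans (≡⇒≋ (cong (λ b → scale b (u i *ₚ Gp ^ₚ (2 * toℕ n))) (sym (coeffs i n))))
                     (scale-cong (coeff (P i) (toℕ n)) (*ₚ-congʳ (u i) (^ₚ-2* Gp (toℕ n)))))
          (sumFin-digits (suc m) (P i) (u i) G² (d i))

r²∘ₚGp : r² ∘ₚ Gp ≋ G²
r²∘ₚGp = by-evaluation (r² ∘ₚ Gp) G²

∘ₚGp∘ₚr² : ∀ a → (a ∘ₚ Gp) ∘ₚ r² ≋ a ∘ₚ G²
∘ₚGp∘ₚr² a = ≋-trans (∘ₚ-assoc a Gp r²) (∘ₚ-congʳ a (by-evaluation (Gp ∘ₚ r²) G²))

v : Fin 3 → Poly
v zero             = X
v (suc zero)       = r+1
v (suc (suc zero)) = r² *ₚ r+1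

u≋r²+r*v∘ₚr² : ∀ i → u i ≋ r²+r *ₚ (v i ∘ₚ r²)
u≋r²+r*v∘ₚr² zero             = by-evaluation _ _
u≋r²+r*v∘ₚr² (suc zero)       = by-evaluation _ _
u≋r²+r*v∘ₚr² (suc (suc zero)) = by-evaluation _ _

Deg<-v : ∀ i → Deg< 4 (v i)
Deg<-v zero             = Deg<-mono (s≤s (s≤s z≤n)) (Deg<-length X)
Deg<-v (suc zero)       = Deg<-mono (s≤s (s≤s z≤n)) (Deg<-length r+1)
Deg<-v (suc (suc zero)) = Deg<-length (r² *ₚ r+1)

L⊆L* : ∀ m f → InL m f → InL* m f
L⊆L* m f (c , f≈) = tabulate (λ i → coeff g (toℕ i)) , ≋⇒≈ f≋r²+r*g∘ₚr²
  where
  N = suc (4 * m + 3)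
  P : Fin 3 → Poly
  P i = fromBits (c i)
  g = sumFin 3 (λ i → v i *ₚ (P i ∘ₚ Gp))
  Deg<-g : Deg< N g
  Deg<-g = Deg<-sumFin 3 λ i →
    subst (λ n → Deg< n (v i *ₚ (P i ∘ₚ Gp))) (cong suc (+-comm 3 (4 * m)))
    (Deg<-*ₚ 4 (4 * m) (Deg<-v i) (Deg<-∘ₚ 4 m (Deg<-fromBits (c i)) (Deg<-length Gp)))
  f≋r²+r*g∘ₚr² : f ≋ r²+r *ₚ (fromBits (λ (i : Fin N) → coeff g (toℕ i)) ∘ₚ r²)
  f≋r²+r*g∘ₚr² = begin
    f
      ≈⟨ ≈⇒≋ f≈ ⟩
    combL m c
      ≈⟨ combL≋ m c P (λ i → Deg<-fromBits (c i)) (λ i → coeff-fromBits (c i)) ⟩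
    sumFin 3 (λ i → u i *ₚ (P i ∘ₚ G²))
      ≈⟨ sumFin-cong 3 (λ i → *ₚ-cong (u≋r²+r*v∘ₚr² i) (≋-sym (∘ₚGp∘ₚr² (P i)))) ⟩
    sumFin 3 (λ i → (r²+r *ₚ (v i ∘ₚ r²)) *ₚ ((P i ∘ₚ Gp) ∘ₚ r²))
      ≈⟨ sumFin-cong 3 (λ i → ≋-trans (*ₚ-assoc r²+r (v i ∘ₚ r²) ((P i ∘ₚ Gp) ∘ₚ r²))
                                      (*ₚ-congʳ r²+r (≋-sym (∘ₚ-*ₚ (v i) (P i ∘ₚ Gp) r²)))) ⟩
    sumFin 3 (λ i → r²+r *ₚ ((v i *ₚ (P i ∘ₚ Gp)) ∘ₚ r²))
      ≈⟨ ≋-sym (sumFin-*ₚ 3 r²+r (λ i → (v i *ₚ (P i ∘ₚ Gp)) ∘ₚ r²)) ⟩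
    r²+r *ₚ sumFin 3 (λ i → (v i *ₚ (P i ∘ₚ Gp)) ∘ₚ r²)
      ≈⟨ *ₚ-congʳ r²+r (≋-sym (sumFin-∘ₚ 3 (λ i → v i *ₚ (P i ∘ₚ Gp)) r²)) ⟩
    r²+r *ₚ (g ∘ₚ r²)
      ≈⟨ *ₚ-congʳ r²+r (∘ₚ-congˡ r² (≋-sym (fromBits-coeff N Deg<-g))) ⟩
    r²+r *ₚ (fromBits (λ (i : Fin N) → coeff g (toℕ i)) ∘ₚ r²) ∎
    where open ≋-Reasoning

r²ⁱ : ℕ → Poly
r²ⁱ i = (X ^ₚ i) ∘ₚ r²

coeff-∘ₚr² : ∀ a n → coeff (a ∘ₚ r²) (n + n) ≡ coeff a n
coeff-∘ₚr² []      n = refl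
coeff-∘ₚr² (b ∷ a) n = trans (≋⇒≈ spread (n + n)) (coeff-spread n)
  where
  S = a ∘ₚ r²
  r²*S≋ : r² *ₚ S ≋ false ∷ false ∷ S
  r²*S≋ = ≋-trans (*ₚ-congˡ S (by-evaluation r² (X *ₚ X))) (≋-trans (*ₚ-assoc X X S)
            (≋-sym (≋-trans (false∷≋X*ₚ (false ∷ S)) (*ₚ-congʳ X (false∷≋X*ₚ S)))))
  spread : (b ∷ a) ∘ₚ r² ≋ b ∷ false ∷ S
  spread = ≋-trans (+ₚ-cong (≋-refl {constant b}) r²*S≋) (∷-cong (xor-identityʳ b) ≋-refl)
  coeff-spread : ∀ n → coeff (b ∷ false ∷ S) (n + n) ≡ coeff (b ∷ a) n
  coeff-spread zero    = refl
  coeff-spread (suc n) = trans (cong (coeff (false ∷ S)) (+-suc n n)) (coeff-∘ₚr² a n)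

∘ₚr²-injective : ∀ {a b} → a ∘ₚ r² ≋ b ∘ₚ r² → a ≋ b
∘ₚr²-injective {a} {b} e =
  ≈⇒≋ λ n → trans (sym (coeff-∘ₚr² a n)) (trans (≋⇒≈ e (n + n)) (coeff-∘ₚr² b n))

expandG-∘ₚr² : ∀ a → expandG a ∘ₚ r² ≋ Σ₄ (λ i → (a i ∘ₚ G²) *ₚ r²ⁱ i)
expandG-∘ₚr² a = ≋-trans (Σ₄-∘ₚ (λ i → (a i ∘ₚ Gp) *ₚ X ^ₚ i) r²)
  (Σ₄-cong (all₄ term))
  where
  term : ∀ i → ((a i ∘ₚ Gp) *ₚ X ^ₚ i) ∘ₚ r² ≋ (a i ∘ₚ G²) *ₚ r²ⁱ i
  term i = ≋-trans (∘ₚ-*ₚ (a i ∘ₚ Gp) (X ^ₚ i) r²) (*ₚ-congˡ (r²ⁱ i) (∘ₚGp∘ₚr² (a i)))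

r²+r*∘ₚr² : ∀ g →
  r²+r *ₚ (g ∘ₚ r²) ≋ Σ₄ (λ i → (coord g i ∘ₚ G²) *ₚ (r²+r *ₚ r²ⁱ i))
r²+r*∘ₚr² g = begin
  r²+r *ₚ (g ∘ₚ r²)
    ≈⟨ *ₚ-congʳ r²+r (≋-trans (∘ₚ-congˡ r² (coord-correct g)) (expandG-∘ₚr² (coord g))) ⟩
  r²+r *ₚ Σ₄ (λ i → Q i *ₚ r²ⁱ i)
    ≈⟨ solve 9 (λ w q₀ q₁ q₂ q₃ y₀ y₁ y₂ y₃ →
           (w ⊗ (q₀ ⊗ y₀ ⊕ q₁ ⊗ y₁ ⊕ q₂ ⊗ y₂ ⊕ q₃ ⊗ y₃))
           ⊜ (q₀ ⊗ (w ⊗ y₀) ⊕ q₁ ⊗ (w ⊗ y₁) ⊕ q₂ ⊗ (w ⊗ y₂) ⊕ q₃ ⊗ (w ⊗ y₃)))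
         ≋-refl r²+r (Q 0) (Q 1) (Q 2) (Q 3) (r²ⁱ 0) (r²ⁱ 1) (r²ⁱ 2) (r²ⁱ 3) ⟩
  Σ₄ (λ i → Q i *ₚ (r²+r *ₚ r²ⁱ i)) ∎
  where
  open ≋-Reasoning
  Q : ℕ → Poly
  Q i = coord g i ∘ₚ G²

L*-coord : (ℕ → Poly) → ℕ → Poly
L*-coord a 0 = X *ₚ (a 1 ∘ₚ r²) +ₚ r² *ₚ (a 3 ∘ₚ r²)
L*-coord a 1 = a 0 ∘ₚ r²
L*-coord a 2 = a 0 ∘ₚ r² +ₚ X *ₚ (a 2 ∘ₚ r²)
L*-coord a _ = X *ₚ (a 3 ∘ₚ r²)

r²+r*∘ₚr²≋expandG : ∀ g → r²+r *ₚ (g ∘ₚ r²) ≋ expandG (L*-coord (coord g))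
r²+r*∘ₚr²≋expandG g = begin
  r²+r *ₚ (g ∘ₚ r²)
    ≈⟨ r²+r*∘ₚr² g ⟩
  Σ₄ (λ i → Q i *ₚ (r²+r *ₚ r²ⁱ i))
    ≈⟨ Σ₄-cong {λ i → Q i *ₚ (r²+r *ₚ r²ⁱ i)} {λ i → Q i *ₚ B i}
         ⟨ *ₚ-congʳ (Q 0) (by-evaluation _ _) , *ₚ-congʳ (Q 1) (by-evaluation _ _)
         , *ₚ-congʳ (Q 2) (by-evaluation _ _) , *ₚ-congʳ (Q 3) (by-evaluation _ _) ⟩ ⟩
  Σ₄ (λ i → Q i *ₚ B i)
    ≈⟨ solve 7 (λ q₀ q₁ q₂ q₃ g g² x →
         (q₀ ⊗ (x ⊛ 2 ⊕ x ⊛ 1) ⊕ q₁ ⊗ (g ⊗ x ⊛ 0) ⊕ q₂ ⊗ (g ⊗ x ⊛ 2)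
            ⊕ q₃ ⊗ (g² ⊗ x ⊛ 0 ⊕ g ⊗ x ⊛ 3))
         ⊜ ((g ⊗ q₁ ⊕ g² ⊗ q₃) ⊗ x ⊛ 0 ⊕ q₀ ⊗ x ⊛ 1 ⊕ (q₀ ⊕ g ⊗ q₂) ⊗ x ⊛ 2
            ⊕ (g ⊗ q₃) ⊗ x ⊛ 3))
         ≋-refl (Q 0) (Q 1) (Q 2) (Q 3) Gp G² X ⟩
  Σ₄ (λ i → C i *ₚ X ^ₚ i)
    ≈⟨ ≋-sym (Σ₄-cong {λ i → (L*-coord (coord g) i ∘ₚ Gp) *ₚ X ^ₚ i} {λ i → C i *ₚ X ^ₚ i}
         ⟨ *ₚ-congˡ (X ^ₚ 0) (≋-trans (∘ₚ-+ₚ (X *ₚ α 1) (r² *ₚ α 3) Gp)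
                                      (+ₚ-cong (X*ₚα∘ₚGp 1) (r²*ₚα∘ₚGp 3)))
         , *ₚ-congˡ (X ^ₚ 1) (α∘ₚGp 0)
         , *ₚ-congˡ (X ^ₚ 2) (≋-trans (∘ₚ-+ₚ (α 0) (X *ₚ α 2) Gp)
                                      (+ₚ-cong (α∘ₚGp 0) (X*ₚα∘ₚGp 2)))
         , *ₚ-congˡ (X ^ₚ 3) (X*ₚα∘ₚGp 3) ⟩) ⟩
  expandG (L*-coord (coord g)) ∎
  where
  open ≋-Reasoning
  Q : ℕ → Poly
  Q i = coord g i ∘ₚ G²
  B : ℕ → Poly
  B 0 = X ^ₚ 2 +ₚ X ^ₚ 1
  B 1 = Gp *ₚ X ^ₚ 0
  B 2 = Gp *ₚ X ^ₚ 2
  B _ = G² *ₚ X ^ₚ 0 +ₚ Gp *ₚ X ^ₚ 3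
  C : ℕ → Poly
  C 0 = Gp *ₚ Q 1 +ₚ G² *ₚ Q 3
  C 1 = Q 0
  C 2 = Q 0 +ₚ Gp *ₚ Q 2
  C _ = Gp *ₚ Q 3
  α : ℕ → Poly
  α i = coord g i ∘ₚ r²
  α∘ₚGp : ∀ i → α i ∘ₚ Gp ≋ Q i
  α∘ₚGp i = ≋-trans (∘ₚ-assoc (coord g i) r² Gp) (∘ₚ-congʳ (coord g i) r²∘ₚGp)
  X*ₚα∘ₚGp : ∀ i → (X *ₚ α i) ∘ₚ Gp ≋ Gp *ₚ Q i
  X*ₚα∘ₚGp i = ≋-trans (∘ₚ-*ₚ X (α i) Gp) (*ₚ-cong (X-∘ₚ Gp) (α∘ₚGp i))
  r²*ₚα∘ₚGp : ∀ i → (r² *ₚ α i) ∘ₚ Gp ≋ G² *ₚ Q i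
  r²*ₚα∘ₚGp i = ≋-trans (∘ₚ-*ₚ r² (α i) Gp) (*ₚ-cong r²∘ₚGp (α∘ₚGp i))

correction-L* : ∀ {f} g → f ≋ r²+r *ₚ (g ∘ₚ r²) →
  correction f ≋ X *ₚ ((coord g 2 +ₚ coord g 3) ∘ₚ r²)
correction-L* {f} g f≋ = begin
  coord f 1 +ₚ coord f 2 +ₚ coord f 3
    ≈⟨ +ₚ-cong (+ₚ-cong (get₁ coords) (get₂ coords)) (get₃ coords) ⟩
  α 0 +ₚ (α 0 +ₚ X *ₚ α 2) +ₚ X *ₚ α 3
    ≈⟨ solve 4 (λ x a b c → (a ⊕ (a ⊕ x ⊗ b) ⊕ x ⊗ c) ⊜ (x ⊗ (b ⊕ c)))
         ≋-refl X (α 0) (α 2) (α 3) ⟩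
  X *ₚ (α 2 +ₚ α 3)
    ≈⟨ *ₚ-congʳ X (≋-sym (∘ₚ-+ₚ (coord g 2) (coord g 3) r²)) ⟩
  X *ₚ ((coord g 2 +ₚ coord g 3) ∘ₚ r²) ∎
  where
  open ≋-Reasoning
  α : ℕ → Poly
  α i = coord g i ∘ₚ r²
  coords = coord-unique (L*-coord (coord g)) (≋-trans f≋ (r²+r*∘ₚr²≋expandG g))

X*ₚ≋[]⇒≋[] : ∀ {p} → X *ₚ p ≋ [] → p ≋ []
X*ₚ≋[]⇒≋[] {p} e = divX-cong (≋-trans (false∷≋X*ₚ p) e)

ker∩L*⇒coord₂≋coord₃ : ∀ {f} g → f ≋ r²+r *ₚ (g ∘ₚ r²) → U+I (U+I f) ≋ [] →
  coord g 2 ≋ coord g 3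
ker∩L*⇒coord₂≋coord₃ {f} g f≋ ker =
  ∘ₚr²-injective (+ₚ≋[]⇒≋ (≋-trans (≋-sym (∘ₚ-+ₚ (coord g 2) (coord g 3) r²))
                                   (X*ₚ≋[]⇒≋[] (≋-trans (≋-sym (correction-L* g f≋)) correction≋[]))))
  where
  correction≋[] : correction f ≋ []
  correction≋[] = ∘ₚGp≋∘ₚFp⇒≋[] {correction f} {correction (U f)}
    (trans (≋⇒≈ (correction-L* g f≋) 0) (coeff₀-*ₚ X ((coord g 2 +ₚ coord g 3) ∘ₚ r²)))
    (+ₚ≋[]⇒≋ (≋-trans (≋-sym (U+I²-formula f)) ker))

L-coord : (ℕ → Poly) → Fin 3 → Poly
L-coord a zero             = a 0 +ₚ a 1
L-coord a (suc zero)       = a 0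
L-coord a (suc (suc zero)) = a 3

-- Uses r² + r = F + G, (r² + r) r² = G and (r² + r) r⁶ = (F + G)² G + (r² + r) r⁴.
r²+r*∘ₚr²≋sumFin : ∀ g → coord g 2 ≋ coord g 3 →
  r²+r *ₚ (g ∘ₚ r²) ≋ sumFin 3 (λ i → u i *ₚ (L-coord (coord g) i ∘ₚ G²))
r²+r*∘ₚr²≋sumFin g a₂≋a₃ = begin
  r²+r *ₚ (g ∘ₚ r²)
    ≈⟨ r²+r*∘ₚr² g ⟩
  Σ₄ (λ i → Q i *ₚ (r²+r *ₚ r²ⁱ i))
    ≈⟨ Σ₄-cong {λ i → Q i *ₚ (r²+r *ₚ r²ⁱ i)} {B}
         ⟨ *ₚ-congʳ (Q 0) (by-evaluation _ _) , *ₚ-congʳ (Q 1) (by-evaluation _ _)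
         , *ₚ-congˡ _ (∘ₚ-congˡ G² a₂≋a₃) , *ₚ-congʳ (Q 3) (by-evaluation _ _) ⟩ ⟩
  Σ₄ B
    ≈⟨ solve 7 (λ q₀ q₁ q₃ u₀ u₁ u₂ w →
         (q₀ ⊗ (u₀ ⊕ u₁) ⊕ q₁ ⊗ u₀ ⊕ q₃ ⊗ w ⊕ q₃ ⊗ (u₂ ⊕ ⊝ w))
         ⊜ (u₀ ⊗ (q₀ ⊕ q₁) ⊕ (u₁ ⊗ q₀ ⊕ (u₂ ⊗ q₃ ⊕ Κ []))))
         ≋-refl (Q 0) (Q 1) (Q 3) (u zero) (u (suc zero)) (u (suc (suc zero))) (r²+r *ₚ r²ⁱ 2) ⟩
  u zero *ₚ (Q 0 +ₚ Q 1) +ₚ (u (suc zero) *ₚ Q 0 +ₚ (u (suc (suc zero)) *ₚ Q 3 +ₚ []))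
    ≈⟨ +ₚ-cong (*ₚ-congʳ (u zero) (≋-sym (∘ₚ-+ₚ (coord g 0) (coord g 1) G²)))
               (≋-refl {u (suc zero) *ₚ Q 0 +ₚ (u (suc (suc zero)) *ₚ Q 3 +ₚ [])}) ⟩
  sumFin 3 (λ i → u i *ₚ (L-coord (coord g) i ∘ₚ G²)) ∎
  where
  open ≋-Reasoning
  Q : ℕ → Poly
  Q i = coord g i ∘ₚ G²
  B : ℕ → Poly
  B 0 = Q 0 *ₚ (u zero +ₚ u (suc zero))
  B 1 = Q 1 *ₚ u zero
  B 2 = Q 3 *ₚ (r²+r *ₚ r²ⁱ 2)
  B _ = Q 3 *ₚ (u (suc (suc zero)) +ₚ r²+r *ₚ r²ⁱ 2)

L*∩ker⊆L : ∀ m f → InL* m f → U+I (U+I f) ≋ [] → InL m f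
L*∩ker⊆L m f (g , f≈) ker = (λ i n → coeff (P i) (toℕ n)) , ≋⇒≈ f≋combL
  where
  f≋ : f ≋ r²+r *ₚ (toList g ∘ₚ r²)
  f≋ = ≈⇒≋ f≈
  P = L-coord (coord (toList g))
  Deg<-coord : ∀₄ (λ i → Deg< (suc m) (coord (toList g) i))
  Deg<-coord = coord-Deg< (suc m) (subst (λ n → Deg< n (toList g))
    (trans (cong suc (+-comm (4 * m) 3)) (sym (*-suc 4 m))) (Deg<-toList g))
  Deg<-P : ∀ i → Deg< (suc m) (P i)
  Deg<-P zero             = Deg<-+ₚ (get₀ Deg<-coord) (get₁ Deg<-coord)
  Deg<-P (suc zero)       = get₀ Deg<-coord
  Deg<-P (suc (suc zero)) = get₃ Deg<-coord
  f≋combL : f ≋ combL m (λ i n → coeff (P i) (toℕ n))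
  f≋combL = begin
    f
      ≈⟨ f≋ ⟩
    r²+r *ₚ (toList g ∘ₚ r²)
      ≈⟨ r²+r*∘ₚr²≋sumFin (toList g) (ker∩L*⇒coord₂≋coord₃ (toList g) f≋ ker) ⟩
    sumFin 3 (λ i → u i *ₚ (P i ∘ₚ G²))
      ≈⟨ ≋-sym (combL≋ m _ P Deg<-P (λ i n → refl)) ⟩
    combL m (λ i n → coeff (P i) (toℕ n)) ∎
    where open ≋-Reasoning

lemma2p11 : (m : ℕ) →
    ((f : Poly) → InL m f → InL* m f)
    × ((f : Poly) → InL m f × U+I (U+I f) ≈ 0ₚ → InL* m f × U+I (U+I f) ≈ 0ₚ)
    × ((f : Poly) → InL* m f × U+I (U+I f) ≈ 0ₚ → InL m f × U+I (U+I f) ≈ 0ₚ)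
lemma2p11 m =
    L⊆L* m
  , (λ f (f∈L , ker) → L⊆L* m f f∈L , ker)
  , (λ f (f∈L* , ker) → L*∩ker⊆L m f f∈L* (≈⇒≋ ker) , ker)
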